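{- Let $a_1,\dots,a_n$ be positive integers, and for $k=1,\dots,n$ let $X_k:\mathbf{a_k}\to\mathbb{R}$ be arbitrary functions. Define $Z:\mathbf{a_1}\times\cdots\times\mathbf{a_n}\to\mathbb{R}$ by $Z(i_1,\dots,i_n)=X_1(i_1)+\cdots+X_n(i_n)$. Then for every positive integer $m$, $$\mathbb{E}(Z;m)=\sum_{k=1}^n\mathbb{E}(X_k;m).$$
   Context: $\mathbf{a}$ denotes the chain $1<2<\cdots<a$, and $\mathbf{a_1}\times\cdots\times\mathbf{a_n}$ has the componentwise order. For a finite poset $P$ and positive integer $m$, $\Omega^{(m)}_P$ is the probability distribution on $P$ assigning $p$ probability proportional to the number of $m$-element multichains $p_1\le\cdots\le p_m$ in $P$ passing through $p$ (i.e. $p=p_j$ for some $j$). For $W:P\to\mathbb{R}$, $\mathbb{E}(W;m)$ denotes the expectation of $W$ with respect to $\Omega^{(m)}_P$ (here $P$ is the domain of $W$).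
   Formalization: The functions $X_k$, and hence $Z$, take values in ℚ rather than ℝ. -}

module Defs where

open import Data.Nat using (ℕ; zero; suc)
open import Data.Fin using (Fin; zero; suc; toℕ)
import Data.Fin as F
import Data.Fin.Properties as FP
open import Data.List using (List; []; _∷_; map; concatMap; filter; length; foldr; allFin)
open import Data.Bool using (Bool; true; false; _∧_; _∨_)
open import Data.Product using (_,_)
open import Data.Integer using (+_)
open import Data.Rational using (ℚ; 0ℚ; _+_; _*_; _/_)
import Data.Nat as N
open import Relation.Nullary using (Dec; yes; no; ¬_)
open import Relation.Nullary.Decidable using (⌊_⌋; map′)
open import Relation.Binary.PropositionalEquality using (_≡_; refl; cong)

-- A finite poset presented by an enumeration of its elements (without
-- repetition), its decidable order relation and decidable equality.
record FinPoset : Set₁ where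
  field
    Carrier : Set
    elems   : List Carrier
    leq?    : Carrier → Carrier → Bool
    eq?     : Carrier → Carrier → Bool

open FinPoset public

seqs : (P : FinPoset) → ℕ → List (List (Carrier P))
seqs P zero    = [] ∷ []
seqs P (suc m) = concatMap (λ x → map (x ∷_) (seqs P m)) (elems P)

isMultichain : (P : FinPoset) → List (Carrier P) → Bool
isMultichain P []           = true
isMultichain P (x ∷ [])     = true
isMultichain P (x ∷ y ∷ xs) = leq? P x y ∧ isMultichain P (y ∷ xs)

passesThrough : (P : FinPoset) → Carrier P → List (Carrier P) → Bool
passesThrough P p []       = false
passesThrough P p (x ∷ xs) = eq? P p x ∨ passesThrough P p xs

countTrue : {A : Set} → (A → Bool) → List A → ℕ
countTrue f []       = 0
countTrue f (x ∷ xs) with f x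
... | true  = suc (countTrue f xs)
... | false = countTrue f xs

multichainsThrough : (P : FinPoset) → ℕ → Carrier P → ℕ
multichainsThrough P m p =
  countTrue (λ c → isMultichain P c ∧ passesThrough P p c) (seqs P m)

sumℚ : List ℚ → ℚ
sumℚ = foldr _+_ 0ℚ

sumℕ : List ℕ → ℕ
sumℕ = foldr N._+_ 0

-- 𝔼(W;m): expectation of W w.r.t. Ω_P^(m)
-- (when the normalising total is 0, which never happens for nonempty P
--  and m ≥ 1, the value is set to 0 by convention)
expect : (P : FinPoset) → (Carrier P → ℚ) → ℕ → ℚ
expect P W m with sumℕ (map (multichainsThrough P m) (elems P))
... | zero  = 0ℚ
... | suc t = (+ 1 / suc t) *
               sumℚ (map (λ p → (+ multichainsThrough P m p / 1) * W p) (elems P))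

-- the chain 𝐚 = 1 < 2 < ⋯ < a, realised as Fin a with its usual order
chain : ℕ → FinPoset
chain a = record
  { Carrier = Fin a
  ; elems   = allFin a
  ; leq?    = λ x y → ⌊ x F.≤? y ⌋
  ; eq?     = λ x y → ⌊ x FP.≟ y ⌋
  }

Tuple : (n : ℕ) → (Fin n → ℕ) → Set
Tuple n a = (k : Fin n) → Fin (a k)

consT : ∀ {n} {a : Fin (suc n) → ℕ} → Fin (a zero) → Tuple n (λ k → a (suc k)) → Tuple (suc n) a
consT i f zero    = i
consT i f (suc k) = f k

allTuples : (n : ℕ) → (a : Fin n → ℕ) → List (Tuple n a)
allTuples zero    a = (λ ()) ∷ []
allTuples (suc n) a =
  concatMap (λ i → map (consT {n} {a} i) (allTuples n (λ k → a (suc k)))) (allFin (a zero))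

productPoset : (n : ℕ) → (Fin n → ℕ) → FinPoset
productPoset n a = record
  { Carrier = Tuple n a
  ; elems   = allTuples n a
  ; leq?    = λ x y → ⌊ FP.all? (λ k → x k F.≤? y k) ⌋
  ; eq?     = λ x y → ⌊ FP.all? (λ k → x k FP.≟ y k) ⌋
  }

-- Write V_m(p) for the number of pairs (multichain p₁ ≤ ⋯ ≤ p_m, index t) with p_t = p.  In a
-- multichain the entries equal to p form one block, so [p occurs in c] is the number of entries equal
-- to p minus the number of repetitions p_t = p_{t+1} = p; deleting one copy identifies these
-- repetitions with the pairs counted by V_{m−1}(p).  Hence p lies on V_m(p) − V_{m−1}(p) multichains
-- of length m.  Splitting a multichain at the index t gives V_m(p) = Σ_{r+s=m−1} Dʳ(p) Uˢ(p), where
-- Dʳ(p) and Uˢ(p) count the multichains of length r + 1 ending at p and of length s + 1 starting at p.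
-- On a chain a telescoping argument shows that V_m is constant, so Ω^(m) is uniform.  On a product of
-- chains Dʳ and Uˢ are products over the coordinates, and summing V_m over the fibre {p : p_k = i}
-- gives V^(k)_m(i) times a factor independent of i; so every coordinate marginal of Ω^(m) is uniform.
-- Hence E(X_k ∘ proj_k; m) = (1/a_k) Σ_i X_k(i) = E(X_k; m), and linearity of E gives the claim.

module Submission where

open import Defs
open import Algebra.Bundles using (CommutativeSemiring; CommutativeRing)
open import Data.Bool using (Bool; true; false; if_then_else_; _∧_; _∨_; not; T)
open import Data.Bool.Properties using (T-∧; T-∨; T-≡; ∧-identityʳ; ∨-identityʳ)
open import Data.Empty using (⊥-elim)
open import Data.Fin using (Fin; zero; suc; toℕ; fromℕ<; punchIn)
import Data.Fin.Properties as Fin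
open import Data.List using (List; []; _∷_; map; concatMap; _++_; allFin; foldr)
open import Data.List.Properties using (map-∘; map-tabulate)
open import Data.Nat using (ℕ; zero; suc; NonZero; >-nonZero; >-nonZero⁻¹)
open import Data.Nat.GeneralisedArithmetic using (fold; fold-+)
import Data.Nat.Properties as ℕ
open import Data.Nat.Tactic.RingSolver using (solve-∀)
open import Data.Product using (_×_; _,_; proj₁; proj₂)
open import Data.Sum using (inj₁; inj₂; [_,_]′)
open import Data.Unit using (tt)
open import Data.Vec.Functional using (removeAt)
open import Function using (_∘_; flip)
open import Function.Bundles using (_⇔_; Equivalence; mk⇔)
open import Relation.Binary.Definitions using (tri<; tri≈; tri>)
open import Relation.Binary.PropositionalEquality as ≡ using (_≡_; module ≡-Reasoning)
open import Relation.Nullary using (Dec; ¬_)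
open import Relation.Nullary.Decidable
  using (⌊_⌋; ⌊⌋-map′; isYes≗does; dec-true; dec-false; does-⇔; toWitness; fromWitness)

open import Algebra.Properties.CommutativeMonoid.Sum ℕ.*-1-commutativeMonoid
  using () renaming (sum to ∏; ∑-distrib-+ to ∏-distrib-*; sum-cong-≗ to ∏-cong; sum-replicate-zero to ∏-ones)
open import Algebra.Properties.CommutativeSemigroup ℕ.+-commutativeSemigroup
  using () renaming (interchange to +-interchange; x∙yz≈y∙xz to x+yz≡y+xz)
open import Algebra.Properties.CommutativeSemigroup ℕ.*-commutativeSemigroup
  using () renaming (x∙yz≈yx∙z to x*yz≡yx*z; x∙yz≈y∙xz to x*yz≡y*xz)

⌊⌋-yes : ∀ {A : Set} (d : Dec A) → A → ⌊ d ⌋ ≡ true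
⌊⌋-yes d a = ≡.trans (isYes≗does d) (dec-true d a)

⌊⌋-no : ∀ {A : Set} (d : Dec A) → ¬ A → ⌊ d ⌋ ≡ false
⌊⌋-no d ¬a = ≡.trans (isYes≗does d) (dec-false d ¬a)

⌊⌋-⇔ : ∀ {A B : Set} → A ⇔ B → (d : Dec A) (d′ : Dec B) → ⌊ d ⌋ ≡ ⌊ d′ ⌋
⌊⌋-⇔ A⇔B d d′ = ≡.trans (isYes≗does d) (≡.trans (does-⇔ A⇔B d d′) (≡.sym (isYes≗does d′)))

module ListSum {c ℓ} (S : CommutativeSemiring c ℓ) where

  open CommutativeSemiring S renaming (Carrier to R) hiding (zero)
  open import Algebra.Properties.CommutativeSemigroup +-commutativeSemigroup using (interchange)
  open import Algebra.Properties.CommutativeSemigroup *-commutativeSemigroup using ()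
    renaming (x∙yz≈yx∙z to x*yz≈yx*z)
  open import Relation.Binary.Reasoning.Setoid setoid

  ∑ : {A : Set} → List A → (A → R) → R
  ∑ xs f = foldr _+_ 0# (map f xs)

  infix 5 ∑
  syntax ∑ xs (λ x → e) = ∑[ x ∈ xs ] e

  𝟙 : Bool → R
  𝟙 b = if b then 1# else 0#

  𝟙-∧ : ∀ a b → 𝟙 (a ∧ b) ≈ 𝟙 a * 𝟙 b
  𝟙-∧ true  b = sym (*-identityˡ (𝟙 b))
  𝟙-∧ false b = sym (zeroˡ (𝟙 b))

  𝟙*-congˡ : ∀ b {u v} → (T b → u ≈ v) → 𝟙 b * u ≈ 𝟙 b * v
  𝟙*-congˡ true  u≈v = *-congˡ (u≈v _)
  𝟙*-congˡ false u≈v = trans (zeroˡ _) (sym (zeroˡ _))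

  private variable A B : Set

  ∑-cong : (xs : List A) {f g : A → R} → (∀ x → f x ≈ g x) → ∑ xs f ≈ ∑ xs g
  ∑-cong []       f≈g = refl
  ∑-cong (x ∷ xs) f≈g = +-cong (f≈g x) (∑-cong xs f≈g)

  ∑-zero : (xs : List A) → ∑[ x ∈ xs ] 0# ≈ 0#
  ∑-zero []       = refl
  ∑-zero (x ∷ xs) = trans (+-identityˡ _) (∑-zero xs)

  ∑-distrib-+ : (xs : List A) (f g : A → R) →
                ∑[ x ∈ xs ] (f x + g x) ≈ ∑ xs f + ∑ xs g
  ∑-distrib-+ []       f g = sym (+-identityˡ 0#)
  ∑-distrib-+ (x ∷ xs) f g = begin
    (f x + g x) + (∑[ y ∈ xs ] (f y + g y)) ≈⟨ +-congˡ (∑-distrib-+ xs f g) ⟩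
    (f x + g x) + (∑ xs f + ∑ xs g)       ≈⟨ interchange _ _ _ _ ⟩
    (f x + ∑ xs f) + (g x + ∑ xs g)       ∎

  *-distribˡ-∑ : (a : R) (xs : List A) (f : A → R) →
                 a * ∑ xs f ≈ ∑[ x ∈ xs ] (a * f x)
  *-distribˡ-∑ a []       f = zeroʳ a
  *-distribˡ-∑ a (x ∷ xs) f = trans (distribˡ a _ _) (+-congˡ (*-distribˡ-∑ a xs f))

  *-distribʳ-∑ : (a : R) (xs : List A) (f : A → R) →
                 ∑ xs f * a ≈ ∑[ x ∈ xs ] (f x * a)
  *-distribʳ-∑ a xs f = trans (*-comm _ a)
    (trans (*-distribˡ-∑ a xs f) (∑-cong xs (λ x → *-comm a (f x))))

  ∑-++ : (xs ys : List A) (f : A → R) → ∑ (xs ++ ys) f ≈ ∑ xs f + ∑ ys f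
  ∑-++ []       ys f = sym (+-identityˡ _)
  ∑-++ (x ∷ xs) ys f = trans (+-congˡ (∑-++ xs ys f)) (sym (+-assoc _ _ _))

  ∑-map : (g : A → B) (xs : List A) (f : B → R) →
          ∑ (map g xs) f ≡ ∑ xs (f ∘ g)
  ∑-map g xs f = ≡.cong (foldr _+_ 0#) (≡.sym (map-∘ xs))

  ∑-concatMap : (g : A → List B) (xs : List A) (f : B → R) →
                ∑ (concatMap g xs) f ≈ ∑[ x ∈ xs ] ∑ (g x) f
  ∑-concatMap g []       f = refl
  ∑-concatMap g (x ∷ xs) f = trans (∑-++ (g x) (concatMap g xs) f) (+-congˡ (∑-concatMap g xs f))

  ∑-comm : (xs : List A) (ys : List B) (f : A → B → R) →
           ∑[ x ∈ xs ] ∑[ y ∈ ys ] f x y ≈ ∑[ y ∈ ys ] ∑[ x ∈ xs ] f x y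
  ∑-comm []       ys f = sym (∑-zero ys)
  ∑-comm (x ∷ xs) ys f =
    trans (+-congˡ (∑-comm xs ys f)) (sym (∑-distrib-+ ys (f x) (λ y → ∑[ x′ ∈ xs ] f x′ y)))

  ∑-allFin-suc : ∀ n (f : Fin (suc n) → R) → ∑ (allFin (suc n)) f ≡ f zero + ∑ (allFin n) (f ∘ suc)
  ∑-allFin-suc n f = ≡.cong (λ ys → f zero + foldr _+_ 0# ys)
    (≡.trans (map-tabulate suc f) (≡.sym (map-tabulate (λ i → i) (f ∘ suc))))

  ∑-allFin-δ : ∀ {n} (i : Fin n) (f : Fin n → R) → ∑[ j ∈ allFin n ] (𝟙 ⌊ j Fin.≟ i ⌋ * f j) ≈ f i
  ∑-allFin-δ {suc n} zero f = begin
    ∑[ j ∈ allFin (suc n) ] (𝟙 ⌊ j Fin.≟ zero ⌋ * f j)   ≡⟨ ∑-allFin-suc n _ ⟩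
    1# * f zero + (∑[ j ∈ allFin n ] 0# * f (suc j))     ≈⟨ +-cong (*-identityˡ _) (∑-cong (allFin n) (λ j → zeroˡ _)) ⟩
    f zero + (∑[ j ∈ allFin n ] 0#)                      ≈⟨ +-congˡ (∑-zero (allFin n)) ⟩
    f zero + 0#                                          ≈⟨ +-identityʳ _ ⟩
    f zero                                               ∎
  ∑-allFin-δ {suc n} (suc i) f = begin
    ∑[ j ∈ allFin (suc n) ] (𝟙 ⌊ j Fin.≟ suc i ⌋ * f j)
      ≡⟨ ∑-allFin-suc n (λ j → 𝟙 ⌊ j Fin.≟ suc i ⌋ * f j) ⟩
    0# * f zero + (∑[ j ∈ allFin n ] 𝟙 ⌊ suc j Fin.≟ suc i ⌋ * f (suc j))
      ≈⟨ +-cong (zeroˡ _) (∑-cong (allFin n) (λ j →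
           reflexive (≡.cong (λ b → 𝟙 b * f (suc j)) (⌊⌋-map′ _ _ (j Fin.≟ i))))) ⟩
    0# + (∑[ j ∈ allFin n ] 𝟙 ⌊ j Fin.≟ i ⌋ * f (suc j))
      ≈⟨ +-congˡ (∑-allFin-δ i (f ∘ suc)) ⟩
    0# + f (suc i)
      ≈⟨ +-identityˡ _ ⟩
    f (suc i)
      ∎

  ∑-allFin-δ′ : ∀ {n} (i : Fin n) (f : Fin n → R) → ∑[ j ∈ allFin n ] 𝟙 ⌊ i Fin.≟ j ⌋ * f j ≈ f i
  ∑-allFin-δ′ {n} i f = trans
    (∑-cong (allFin n) (λ j → reflexive (≡.cong (λ b → 𝟙 b * f j) (⌊⌋-⇔ (mk⇔ ≡.sym ≡.sym) (i Fin.≟ j) (j Fin.≟ i)))))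
    (∑-allFin-δ i f)

  ∑-fibres : ∀ {n} (xs : List A) (π : A → Fin n) (W : A → R) (g : Fin n → R) →
    ∑[ x ∈ xs ] W x * g (π x) ≈ ∑[ i ∈ allFin n ] (∑[ x ∈ xs ] 𝟙 ⌊ π x Fin.≟ i ⌋ * W x) * g i
  ∑-fibres {n = n} xs π W g = begin
    ∑[ x ∈ xs ] W x * g (π x)
      ≈⟨ ∑-cong xs (λ x → *-congˡ (sym (∑-allFin-δ′ (π x) g))) ⟩
    ∑[ x ∈ xs ] W x * (∑[ i ∈ allFin n ] 𝟙 ⌊ π x Fin.≟ i ⌋ * g i)
      ≈⟨ ∑-cong xs (λ x → *-distribˡ-∑ (W x) (allFin n) _) ⟩
    ∑[ x ∈ xs ] ∑[ i ∈ allFin n ] W x * (𝟙 ⌊ π x Fin.≟ i ⌋ * g i)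
      ≈⟨ ∑-comm xs (allFin n) _ ⟩
    ∑[ i ∈ allFin n ] ∑[ x ∈ xs ] W x * (𝟙 ⌊ π x Fin.≟ i ⌋ * g i)
      ≈⟨ ∑-cong (allFin n) (λ i → ∑-cong xs (λ x → x*yz≈yx*z (W x) (𝟙 ⌊ π x Fin.≟ i ⌋) (g i))) ⟩
    ∑[ i ∈ allFin n ] ∑[ x ∈ xs ] 𝟙 ⌊ π x Fin.≟ i ⌋ * W x * g i
      ≈⟨ ∑-cong (allFin n) (λ i → *-distribʳ-∑ (g i) xs _) ⟨
    ∑[ i ∈ allFin n ] (∑[ x ∈ xs ] 𝟙 ⌊ π x Fin.≟ i ⌋ * W x) * g i
      ∎

open import Data.Nat using (_+_; _*_; _≤_; _<_; z≤n; s≤s⁻¹)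
open ListSum ℕ.+-*-commutativeSemiring

antidiagonal : (ℕ → ℕ → ℕ) → ℕ → ℕ
antidiagonal φ zero    = φ 0 0
antidiagonal φ (suc j) = φ 0 (suc j) + antidiagonal (λ r s → φ (suc r) s) j

module _ where
  open ≡-Reasoning

  antidiagonal-cong : ∀ j {φ ψ : ℕ → ℕ → ℕ} → (∀ r s → φ r s ≡ ψ r s) → antidiagonal φ j ≡ antidiagonal ψ j
  antidiagonal-cong zero    φ≡ψ = φ≡ψ 0 0
  antidiagonal-cong (suc j) φ≡ψ = ≡.cong₂ _+_ (φ≡ψ 0 (suc j)) (antidiagonal-cong j (λ r → φ≡ψ (suc r)))

  antidiagonal-distrib-+ : ∀ j (φ ψ : ℕ → ℕ → ℕ) →
    antidiagonal (λ r s → φ r s + ψ r s) j ≡ antidiagonal φ j + antidiagonal ψ j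
  antidiagonal-distrib-+ zero    φ ψ = ≡.refl
  antidiagonal-distrib-+ (suc j) φ ψ = begin
    (φ 0 (suc j) + ψ 0 (suc j)) + antidiagonal (λ r s → φ (suc r) s + ψ (suc r) s) j
      ≡⟨ ≡.cong (φ 0 (suc j) + ψ 0 (suc j) +_) (antidiagonal-distrib-+ j _ _) ⟩
    (φ 0 (suc j) + ψ 0 (suc j)) + (antidiagonal (λ r s → φ (suc r) s) j + antidiagonal (λ r s → ψ (suc r) s) j)
      ≡⟨ +-interchange (φ 0 (suc j)) (ψ 0 (suc j)) _ _ ⟩
    (φ 0 (suc j) + antidiagonal (λ r s → φ (suc r) s) j) + (ψ 0 (suc j) + antidiagonal (λ r s → ψ (suc r) s) j)
      ∎

  *-distribˡ-antidiagonal : ∀ c j (φ : ℕ → ℕ → ℕ) → c * antidiagonal φ j ≡ antidiagonal (λ r s → c * φ r s) j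
  *-distribˡ-antidiagonal c zero    φ = ≡.refl
  *-distribˡ-antidiagonal c (suc j) φ =
    ≡.trans (ℕ.*-distribˡ-+ c _ _) (≡.cong (c * φ 0 (suc j) +_) (*-distribˡ-antidiagonal c j _))

  ∑-antidiagonal : ∀ {A : Set} (xs : List A) j (φ : A → ℕ → ℕ → ℕ) →
    ∑[ x ∈ xs ] antidiagonal (φ x) j ≡ antidiagonal (λ r s → ∑[ x ∈ xs ] φ x r s) j
  ∑-antidiagonal xs zero    φ = ≡.refl
  ∑-antidiagonal xs (suc j) φ =
    ≡.trans (∑-distrib-+ xs _ _) (≡.cong ((∑[ x ∈ xs ] φ x 0 (suc j)) +_) (∑-antidiagonal xs j _))

  antidiagonal-suc-last : ∀ j (φ : ℕ → ℕ → ℕ) →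
    antidiagonal φ (suc j) ≡ φ (suc j) 0 + antidiagonal (λ r s → φ r (suc s)) j
  antidiagonal-suc-last zero    φ = ℕ.+-comm (φ 0 1) (φ 1 0)
  antidiagonal-suc-last (suc j) φ = begin
    φ 0 (2 + j) + antidiagonal (λ r s → φ (suc r) s) (suc j)
      ≡⟨ ≡.cong (φ 0 (2 + j) +_) (antidiagonal-suc-last j (λ r s → φ (suc r) s)) ⟩
    φ 0 (2 + j) + (φ (2 + j) 0 + antidiagonal (λ r s → φ (suc r) (suc s)) j)
      ≡⟨ x+yz≡y+xz (φ 0 (2 + j)) (φ (2 + j) 0) _ ⟩
    φ (2 + j) 0 + (φ 0 (2 + j) + antidiagonal (λ r s → φ (suc r) (suc s)) j)
      ∎

  antidiagonal-*-diagonal : ∀ j (φ : ℕ → ℕ → ℕ) (Q : ℕ → ℕ) →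
    antidiagonal (λ r s → φ r s * Q (r + s)) j ≡ antidiagonal φ j * Q j
  antidiagonal-*-diagonal zero    φ Q = ≡.refl
  antidiagonal-*-diagonal (suc j) φ Q =
    ≡.trans (≡.cong (φ 0 (suc j) * Q (suc j) +_) (antidiagonal-*-diagonal j (λ r s → φ (suc r) s) (Q ∘ suc)))
            (≡.sym (ℕ.*-distribʳ-+ (Q (suc j)) (φ 0 (suc j)) (antidiagonal (λ r s → φ (suc r) s) j)))

module Kernel {C : Set} (E : List C) where
  open ≡-Reasoning

  kernel : (C → C → Bool) → (C → ℕ) → C → ℕ
  kernel R h x = ∑[ y ∈ E ] 𝟙 (R x y) * h y

  kernel^ : (C → C → Bool) → ℕ → (C → ℕ) → C → ℕ
  kernel^ R r h = fold h (kernel R) r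

  module _ (R : C → C → Bool) where

    kernel-cong : ∀ {h h′ : C → ℕ} → (∀ y → h y ≡ h′ y) → ∀ x → kernel R h x ≡ kernel R h′ x
    kernel-cong h≗h′ x = ∑-cong E (λ y → ≡.cong (𝟙 (R x y) *_) (h≗h′ y))

    kernel^-cong : ∀ {h h′ : C → ℕ} → (∀ y → h y ≡ h′ y) → ∀ r x → kernel^ R r h x ≡ kernel^ R r h′ x
    kernel^-cong h≗h′ zero    = h≗h′
    kernel^-cong h≗h′ (suc r) = kernel-cong (kernel^-cong h≗h′ r)

    kernel^-suc′ : ∀ r h → kernel^ R (suc r) h ≡ kernel^ R r (kernel R h)
    kernel^-suc′ r h = ≡.trans (≡.cong (fold h (kernel R)) (ℕ.+-comm 1 r)) (fold-+ h (kernel R) r)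

    kernel-zero : ∀ x → kernel R (λ _ → 0) x ≡ 0
    kernel-zero x = ≡.trans (∑-cong E (λ y → ℕ.*-zeroʳ (𝟙 (R x y)))) (∑-zero E)

    kernel-distrib-+ : ∀ h h′ x → kernel R (λ y → h y + h′ y) x ≡ kernel R h x + kernel R h′ x
    kernel-distrib-+ h h′ x =
      ≡.trans (∑-cong E (λ y → ℕ.*-distribˡ-+ (𝟙 (R x y)) (h y) (h′ y))) (∑-distrib-+ E _ _)

    kernel-antidiagonal : ∀ j (φ : C → ℕ → ℕ → ℕ) x →
      kernel R (λ y → antidiagonal (φ y) j) x ≡ antidiagonal (λ r s → kernel R (λ y → φ y r s) x) j
    kernel-antidiagonal j φ x =
      ≡.trans (∑-cong E (λ y → *-distribˡ-antidiagonal (𝟙 (R x y)) j (φ y))) (∑-antidiagonal E j _)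

    ∑-*-kernel : ∀ g h → ∑[ x ∈ E ] g x * kernel R h x ≡ ∑[ y ∈ E ] kernel (flip R) g y * h y
    ∑-*-kernel g h = begin
      ∑[ x ∈ E ] g x * kernel R h x                  ≡⟨ ∑-cong E (λ x → *-distribˡ-∑ (g x) E _) ⟩
      ∑[ x ∈ E ] ∑[ y ∈ E ] g x * (𝟙 (R x y) * h y)  ≡⟨ ∑-comm E E _ ⟩
      ∑[ y ∈ E ] ∑[ x ∈ E ] g x * (𝟙 (R x y) * h y)  ≡⟨ ∑-cong E (λ y → ∑-cong E (λ x →
                                                           x*yz≡yx*z (g x) (𝟙 (R x y)) (h y))) ⟩
      ∑[ y ∈ E ] ∑[ x ∈ E ] 𝟙 (R x y) * g x * h y    ≡⟨ ∑-cong E (λ y → *-distribʳ-∑ (h y) E _) ⟨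
      ∑[ y ∈ E ] kernel (flip R) g y * h y           ∎

  ∑-*-kernel^ : ∀ R r g h → ∑[ x ∈ E ] g x * kernel^ R r h x ≡ ∑[ y ∈ E ] kernel^ (flip R) r g y * h y
  ∑-*-kernel^ R zero    g h = ≡.refl
  ∑-*-kernel^ R (suc r) g h = begin
    ∑[ x ∈ E ] g x * kernel R (kernel^ R r h) x                 ≡⟨ ∑-*-kernel R g _ ⟩
    ∑[ y ∈ E ] kernel (flip R) g y * kernel^ R r h y            ≡⟨ ∑-*-kernel^ R r _ h ⟩
    ∑[ y ∈ E ] kernel^ (flip R) r (kernel (flip R) g) y * h y   ≡⟨ ≡.cong (λ k → ∑[ y ∈ E ] k y * h y)
                                                                           (kernel^-suc′ (flip R) r g) ⟨
    ∑[ y ∈ E ] kernel^ (flip R) (suc r) g y * h y               ∎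

  ∑-kernel^ : ∀ R r h → ∑ E (kernel^ R r h) ≡ ∑[ y ∈ E ] kernel^ (flip R) r (λ _ → 1) y * h y
  ∑-kernel^ R r h = ≡.trans (∑-cong E (λ x → ≡.sym (ℕ.*-identityˡ _))) (∑-*-kernel^ R r (λ _ → 1) h)

countTrue-∑ : ∀ {A : Set} (g : A → Bool) xs → countTrue g xs ≡ ∑[ x ∈ xs ] 𝟙 (g x)
countTrue-∑ g []       = ≡.refl
countTrue-∑ g (x ∷ xs) with g x
... | true  = ≡.cong suc (countTrue-∑ g xs)
... | false = countTrue-∑ g xs

∑-mono-≤ : ∀ {A : Set} (xs : List A) {f g : A → ℕ} → (∀ x → f x ≤ g x) → ∑ xs f ≤ ∑ xs g
∑-mono-≤ []       f≤g = z≤n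
∑-mono-≤ (x ∷ xs) f≤g = ℕ.+-mono-≤ (f≤g x) (∑-mono-≤ xs f≤g)

𝟙*-≤ : ∀ b v → 𝟙 b * v ≤ v
𝟙*-≤ true  v = ℕ.≤-reflexive (ℕ.*-identityˡ v)
𝟙*-≤ false v = z≤n

𝟙-∨ : ∀ a b → 𝟙 (a ∨ b) ≡ 𝟙 b + 𝟙 a * 𝟙 (not b)
𝟙-∨ true  true  = ≡.refl
𝟙-∨ true  false = ≡.refl
𝟙-∨ false true  = ≡.refl
𝟙-∨ false false = ≡.refl

T-injective : ∀ {a b} → (T a → T b) → (T b → T a) → a ≡ b
T-injective {false} {false} _ _ = ≡.refl
T-injective {false} {true}  _ g = ⊥-elim (g tt)
T-injective {true}  {false} f _ = ⊥-elim (f tt)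
T-injective {true}  {true}  _ _ = ≡.refl

-- eq? has to decide the equivalence induced by leq?, rather than _≡_: the carrier of productPoset is a
-- function type.  elems then enumerates every element exactly once up to that equivalence.
record IsFinPoset (P : FinPoset) : Set where
  field
    ≼-refl          : ∀ x → T (leq? P x x)
    ≼-trans         : ∀ {x y z} → T (leq? P x y) → T (leq? P y z) → T (leq? P x z)
    ≈⇔≼∧≽           : ∀ {x y} → T (eq? P x y) ⇔ (T (leq? P x y) × T (leq? P y x))
    enumerates-once : ∀ x → ∑[ y ∈ elems P ] 𝟙 (eq? P y x) ≡ 1

pushforward : (P : FinPoset) {a : ℕ} → (Carrier P → Fin a) → (Carrier P → ℕ) → Fin a → ℕ
pushforward P π g i = ∑[ y ∈ elems P ] 𝟙 ⌊ π y Fin.≟ i ⌋ * g y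

module Multichains {P : FinPoset} (isFinPoset : IsFinPoset P) where
  open IsFinPoset isFinPoset
  open Kernel (elems P) public
  open ≡-Reasoning

  private
    C : Set
    C = Carrier P
    E : List C
    E = elems P
    mc : List C → Bool
    mc = isMultichain P
    pt : C → List C → Bool
    pt = passesThrough P

  _≼_ _≈_ : C → C → Set
  x ≼ y = T (leq? P x y)
  x ≈ y = T (eq? P x y)

  ≈⇒≼ : ∀ {x y} → x ≈ y → x ≼ y
  ≈⇒≼ = proj₁ ∘ Equivalence.to ≈⇔≼∧≽

  ≈⇒≽ : ∀ {x y} → x ≈ y → y ≼ x
  ≈⇒≽ = proj₂ ∘ Equivalence.to ≈⇔≼∧≽

  ≼-antisym : ∀ {x y} → x ≼ y → y ≼ x → x ≈ y
  ≼-antisym x≼y y≼x = Equivalence.from ≈⇔≼∧≽ (x≼y , y≼x)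

  ≈-refl : ∀ x → x ≈ x
  ≈-refl x = ≼-antisym (≼-refl x) (≼-refl x)

  ≈-sym : ∀ {x y} → x ≈ y → y ≈ x
  ≈-sym x≈y = ≼-antisym (≈⇒≽ x≈y) (≈⇒≼ x≈y)

  ≈-trans : ∀ {x y z} → x ≈ y → y ≈ z → x ≈ z
  ≈-trans x≈y y≈z = ≼-antisym (≼-trans (≈⇒≼ x≈y) (≈⇒≼ y≈z)) (≼-trans (≈⇒≽ y≈z) (≈⇒≽ x≈y))

  eq?-respˡ : ∀ {x x′} y → x ≈ x′ → eq? P x y ≡ eq? P x′ y
  eq?-respˡ y x≈x′ = T-injective (≈-trans (≈-sym x≈x′)) (≈-trans x≈x′)

  eq?-respʳ : ∀ x {y y′} → y ≈ y′ → eq? P x y ≡ eq? P x y′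
  eq?-respʳ x y≈y′ = T-injective (λ x≈y → ≈-trans x≈y y≈y′) (λ x≈y′ → ≈-trans x≈y′ (≈-sym y≈y′))

  leq?-respˡ : ∀ {x x′} y → x ≈ x′ → leq? P x y ≡ leq? P x′ y
  leq?-respˡ y x≈x′ = T-injective (≼-trans (≈⇒≽ x≈x′)) (≼-trans (≈⇒≼ x≈x′))

  Respects : (C → ℕ) → Set
  Respects h = ∀ {y y′} → y ≈ y′ → h y ≡ h y′

  ∑-δ : ∀ {h} → Respects h → ∀ x → ∑[ y ∈ E ] 𝟙 (eq? P y x) * h y ≡ h x
  ∑-δ {h} resp x = begin
    ∑[ y ∈ E ] 𝟙 (eq? P y x) * h y    ≡⟨ ∑-cong E (λ y → 𝟙*-congˡ (eq? P y x) resp) ⟩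
    ∑[ y ∈ E ] 𝟙 (eq? P y x) * h x    ≡⟨ *-distribʳ-∑ (h x) E _ ⟨
    (∑[ y ∈ E ] 𝟙 (eq? P y x)) * h x  ≡⟨ ≡.cong (_* h x) (enumerates-once x) ⟩
    1 * h x                           ≡⟨ ℕ.*-identityˡ (h x) ⟩
    h x                               ∎

  ≤-∑ : ∀ {h} → Respects h → ∀ x → h x ≤ ∑ E h
  ≤-∑ resp x = ℕ.≤-trans (ℕ.≤-reflexive (≡.sym (∑-δ resp x))) (∑-mono-≤ E (λ y → 𝟙*-≤ (eq? P y x) _))

  isMultichain-resp : ∀ {x x′} c → x ≈ x′ → mc (x ∷ c) ≡ mc (x′ ∷ c)
  isMultichain-resp []      x≈x′ = ≡.refl
  isMultichain-resp (y ∷ c) x≈x′ = ≡.cong (_∧ mc (y ∷ c)) (leq?-respˡ y x≈x′)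

  passesThrough-resp : ∀ {p p′} c → p ≈ p′ → pt p c ≡ pt p′ c
  passesThrough-resp []      p≈p′ = ≡.refl
  passesThrough-resp (z ∷ c) p≈p′ = ≡.cong₂ _∨_ (eq?-respˡ z p≈p′) (passesThrough-resp c p≈p′)

  multichainsThrough-resp : ∀ m → Respects (multichainsThrough P m)
  multichainsThrough-resp m {p} {p′} p≈p′ = begin
    countTrue (λ c → mc c ∧ pt p c) (seqs P m)    ≡⟨ countTrue-∑ _ (seqs P m) ⟩
    ∑[ c ∈ seqs P m ] 𝟙 (mc c ∧ pt p c)           ≡⟨ ∑-cong (seqs P m) (λ c →
                                                       ≡.cong (λ b → 𝟙 (mc c ∧ b)) (passesThrough-resp c p≈p′)) ⟩
    ∑[ c ∈ seqs P m ] 𝟙 (mc c ∧ pt p′ c)          ≡⟨ countTrue-∑ _ (seqs P m) ⟨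
    countTrue (λ c → mc c ∧ pt p′ c) (seqs P m)   ∎

  below-head : ∀ {x y} c → T (mc (y ∷ c)) → T (pt x c) → y ≼ x
  below-head (z ∷ c) mc-yzc x∈zc with Equivalence.to T-∧ mc-yzc | Equivalence.to T-∨ x∈zc
  ... | y≼z , _      | inj₁ x≈z  = ≼-trans y≼z (≈⇒≽ x≈z)
  ... | y≼z , mc-zc  | inj₂ x∈c  = ≼-trans y≼z (below-head c mc-zc x∈c)

  passesThrough-head : ∀ {x y} c → x ≼ y → T (mc (y ∷ c)) → pt x (y ∷ c) ≡ eq? P x y
  passesThrough-head c x≼y mc-yc = T-injective
    (λ x∈yc → [ (λ x≈y → x≈y) , (λ x∈c → ≼-antisym x≼y (below-head c mc-yc x∈c)) ]′ (Equivalence.to T-∨ x∈yc))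
    (λ x≈y → Equivalence.from T-∨ (inj₁ x≈y))

  lt? : C → C → Bool
  lt? x y = leq? P x y ∧ not (eq? P x y)

  up down up⁺ : (C → ℕ) → C → ℕ
  up   = kernel (leq? P)
  down = kernel (flip (leq? P))
  up⁺  = kernel lt?

  up^ down^ : ℕ → (C → ℕ) → C → ℕ
  up^   = kernel^ (leq? P)
  down^ = kernel^ (flip (leq? P))

  up-resp : ∀ h → Respects (up h)
  up-resp h x≈x′ = ∑-cong E (λ y → ≡.cong (λ b → 𝟙 b * h y) (leq?-respˡ y x≈x′))

  up^-resp : ∀ r → Respects (up^ r (λ _ → 1))
  up^-resp zero    _ = ≡.refl
  up^-resp (suc r)   = up-resp _

  𝟙-≼-split : ∀ x y → 𝟙 (leq? P x y) ≡ 𝟙 (eq? P y x) + 𝟙 (lt? x y)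
  𝟙-≼-split x y rewrite T-injective {eq? P y x} {eq? P x y} ≈-sym ≈-sym
    with eq? P x y in x≈y | leq? P x y in x≼y
  ... | true  | true  = ≡.refl
  ... | true  | false = ⊥-elim (≡.subst T x≼y (≈⇒≼ (≡.subst T (≡.sym x≈y) tt)))
  ... | false | b     = ≡.cong 𝟙 (≡.sym (∧-identityʳ b))

  up-split : ∀ {h} → Respects h → ∀ x → up h x ≡ h x + up⁺ h x
  up-split {h} resp x = begin
    ∑[ y ∈ E ] 𝟙 (leq? P x y) * h y
      ≡⟨ ∑-cong E (λ y → ≡.trans (≡.cong (_* h y) (𝟙-≼-split x y))
                                 (ℕ.*-distribʳ-+ (h y) (𝟙 (eq? P y x)) (𝟙 (lt? x y)))) ⟩
    ∑[ y ∈ E ] (𝟙 (eq? P y x) * h y + 𝟙 (lt? x y) * h y)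
      ≡⟨ ∑-distrib-+ E _ _ ⟩
    (∑[ y ∈ E ] 𝟙 (eq? P y x) * h y) + up⁺ h x
      ≡⟨ ≡.cong (_+ up⁺ h x) (∑-δ resp x) ⟩
    h x + up⁺ h x
      ∎

  ≤-up : ∀ {h} → Respects h → ∀ x → h x ≤ up h x
  ≤-up resp x = ℕ.≤-trans (ℕ.m≤m+n _ _) (ℕ.≤-reflexive (≡.sym (up-split resp x)))

  ∑-seqs-suc : ∀ j (F : List C → ℕ) → ∑ (seqs P (suc j)) F ≡ ∑[ y ∈ E ] ∑[ c ∈ seqs P j ] F (y ∷ c)
  ∑-seqs-suc j F =
    ≡.trans (∑-concatMap (λ y → map (y ∷_) (seqs P j)) E F) (∑-cong E (λ y → ∑-map (y ∷_) (seqs P j) F))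

  chainsFrom : ℕ → C → ℕ
  chainsFrom j x = ∑[ c ∈ seqs P j ] 𝟙 (mc (x ∷ c))

  chainsFrom≡up^ : ∀ j x → chainsFrom j x ≡ up^ j (λ _ → 1) x
  chainsFrom≡up^ zero    x = ≡.refl
  chainsFrom≡up^ (suc j) x = begin
    chainsFrom (suc j) x
      ≡⟨ ∑-seqs-suc j _ ⟩
    ∑[ y ∈ E ] ∑[ c ∈ seqs P j ] 𝟙 (leq? P x y ∧ mc (y ∷ c))
      ≡⟨ ∑-cong E (λ y → ∑-cong (seqs P j) (λ c → 𝟙-∧ (leq? P x y) (mc (y ∷ c)))) ⟩
    ∑[ y ∈ E ] ∑[ c ∈ seqs P j ] 𝟙 (leq? P x y) * 𝟙 (mc (y ∷ c))
      ≡⟨ ∑-cong E (λ y → *-distribˡ-∑ (𝟙 (leq? P x y)) (seqs P j) (λ c → 𝟙 (mc (y ∷ c)))) ⟨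
    up (chainsFrom j) x
      ≡⟨ kernel-cong (leq? P) (λ y → chainsFrom≡up^ j y) x ⟩
    up^ (suc j) (λ _ → 1) x
      ∎

  up^-pos : ∀ j x → 1 ≤ up^ j (λ _ → 1) x
  up^-pos zero    x = ℕ.≤-refl
  up^-pos (suc j) x = ℕ.≤-trans (up^-pos j x) (≤-up (up^-resp j) x)

  multichainsThrough-suc : ∀ j x → multichainsThrough P (suc j) x ≡
    ∑[ y ∈ E ] ∑[ c ∈ seqs P j ] 𝟙 (mc (y ∷ c) ∧ pt x (y ∷ c))
  multichainsThrough-suc j x = ≡.trans (countTrue-∑ _ (seqs P (suc j))) (∑-seqs-suc j _)

  multichainsThrough-pos : ∀ j x → 1 ≤ multichainsThrough P (suc j) x
  multichainsThrough-pos j x =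
    ℕ.≤-trans (ℕ.≤-trans (up^-pos j x) (ℕ.≤-reflexive (≡.sym startingHere-x)))
              (ℕ.≤-trans (≤-∑ startingHere-resp x) (ℕ.≤-reflexive (≡.sym (multichainsThrough-suc j x))))
    where
    startingHere : C → ℕ
    startingHere y = ∑[ c ∈ seqs P j ] 𝟙 (mc (y ∷ c) ∧ pt x (y ∷ c))
    x∈x∷c : ∀ {c} → pt x (x ∷ c) ≡ true
    x∈x∷c = Equivalence.to T-≡ (Equivalence.from T-∨ (inj₁ (≈-refl x)))
    startingHere-x : startingHere x ≡ up^ j (λ _ → 1) x
    startingHere-x = ≡.trans (∑-cong (seqs P j) (λ c → ≡.cong (λ b → 𝟙 (mc (x ∷ c) ∧ b)) (x∈x∷c {c})))
              (≡.trans (∑-cong (seqs P j) (λ c → ≡.cong 𝟙 (∧-identityʳ (mc (x ∷ c))))) (chainsFrom≡up^ j x))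
    startingHere-resp : Respects startingHere
    startingHere-resp y≈y′ = ∑-cong (seqs P j) (λ c →
      ≡.cong 𝟙 (≡.cong₂ _∧_ (isMultichain-resp c y≈y′) (≡.cong (_∨ pt x c) (eq?-respʳ x y≈y′))))

  total-pos : C → ∀ j → 1 ≤ ∑ E (multichainsThrough P (suc j))
  total-pos x j = ℕ.≤-trans (multichainsThrough-pos j x) (≤-∑ (multichainsThrough-resp (suc j)) x)

  distinctSum : (C → ℕ) → List C → ℕ
  distinctSum f c = ∑[ p ∈ E ] 𝟙 (pt p c) * f p

  distinctSum-∷ : ∀ {f} → Respects f → ∀ x c → distinctSum f (x ∷ c) ≡ distinctSum f c + 𝟙 (not (pt x c)) * f x
  distinctSum-∷ {f} resp x c = begin
    ∑[ p ∈ E ] 𝟙 (eq? P p x ∨ pt p c) * f p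
      ≡⟨ ∑-cong E (λ p → ≡.trans (≡.cong (_* f p) (𝟙-∨ (eq? P p x) (pt p c))) (split p)) ⟩
    ∑[ p ∈ E ] (𝟙 (pt p c) * f p + 𝟙 (eq? P p x) * (𝟙 (not (pt p c)) * f p))
      ≡⟨ ∑-distrib-+ E _ _ ⟩
    distinctSum f c + (∑[ p ∈ E ] 𝟙 (eq? P p x) * (𝟙 (not (pt p c)) * f p))
      ≡⟨ ≡.cong (distinctSum f c +_) (∑-δ missing-resp x) ⟩
    distinctSum f c + 𝟙 (not (pt x c)) * f x
      ∎
    where
    split : ∀ p → (𝟙 (pt p c) + 𝟙 (eq? P p x) * 𝟙 (not (pt p c))) * f p
                  ≡ 𝟙 (pt p c) * f p + 𝟙 (eq? P p x) * (𝟙 (not (pt p c)) * f p)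
    split p = ≡.trans (ℕ.*-distribʳ-+ (f p) (𝟙 (pt p c)) _)
                      (≡.cong (𝟙 (pt p c) * f p +_) (ℕ.*-assoc (𝟙 (eq? P p x)) _ (f p)))
    missing-resp : Respects (λ p → 𝟙 (not (pt p c)) * f p)
    missing-resp p≈p′ = ≡.cong₂ (λ b v → 𝟙 (not b) * v) (passesThrough-resp c p≈p′) (resp p≈p′)

  distinct : (C → ℕ) → ℕ → C → ℕ
  distinct f j x = ∑[ c ∈ seqs P j ] 𝟙 (mc (x ∷ c)) * distinctSum f (x ∷ c)

  ∑-*-multichainsThrough : ∀ f j → ∑[ p ∈ E ] f p * multichainsThrough P (suc j) p ≡ ∑ E (distinct f j)
  ∑-*-multichainsThrough f j = begin
    ∑[ p ∈ E ] f p * multichainsThrough P (suc j) p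
      ≡⟨ ∑-cong E (λ p → ≡.cong (f p *_) (multichainsThrough-suc j p)) ⟩
    ∑[ p ∈ E ] f p * (∑[ x ∈ E ] ∑[ c ∈ seqs P j ] 𝟙 (mc (x ∷ c) ∧ pt p (x ∷ c)))
      ≡⟨ ∑-cong E (λ p → ≡.trans (*-distribˡ-∑ (f p) E _) (∑-cong E (λ x → *-distribˡ-∑ (f p) (seqs P j) _))) ⟩
    ∑[ p ∈ E ] ∑[ x ∈ E ] ∑[ c ∈ seqs P j ] f p * 𝟙 (mc (x ∷ c) ∧ pt p (x ∷ c))
      ≡⟨ ∑-comm E E _ ⟩
    ∑[ x ∈ E ] ∑[ p ∈ E ] ∑[ c ∈ seqs P j ] f p * 𝟙 (mc (x ∷ c) ∧ pt p (x ∷ c))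
      ≡⟨ ∑-cong E (λ x → ∑-comm E (seqs P j) _) ⟩
    ∑[ x ∈ E ] ∑[ c ∈ seqs P j ] ∑[ p ∈ E ] f p * 𝟙 (mc (x ∷ c) ∧ pt p (x ∷ c))
      ≡⟨ ∑-cong E (λ x → ∑-cong (seqs P j) (λ c → ≡.trans (∑-cong E (rearrange x c))
                                                       (≡.sym (*-distribˡ-∑ (𝟙 (mc (x ∷ c))) E _)))) ⟩
    ∑ E (distinct f j)
      ∎
    where
    rearrange : ∀ x c p → f p * 𝟙 (mc (x ∷ c) ∧ pt p (x ∷ c)) ≡ 𝟙 (mc (x ∷ c)) * (𝟙 (pt p (x ∷ c)) * f p)
    rearrange x c p = ≡.trans (ℕ.*-comm (f p) _) (≡.trans (≡.cong (_* f p) (𝟙-∧ (mc (x ∷ c)) (pt p (x ∷ c))))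
                              (ℕ.*-assoc (𝟙 (mc (x ∷ c))) (𝟙 (pt p (x ∷ c))) (f p)))

  distinct-zero : ∀ {f} → Respects f → ∀ x → distinct f 0 x ≡ f x
  distinct-zero {f} resp x = begin
    1 * distinctSum f (x ∷ []) + 0                 ≡⟨ ℕ.+-identityʳ _ ⟩
    1 * distinctSum f (x ∷ [])                     ≡⟨ ℕ.*-identityˡ _ ⟩
    ∑[ p ∈ E ] 𝟙 (eq? P p x ∨ false) * f p         ≡⟨ ∑-cong E (λ p →
                                                        ≡.cong (λ b → 𝟙 b * f p) (∨-identityʳ (eq? P p x))) ⟩
    ∑[ p ∈ E ] 𝟙 (eq? P p x) * f p                 ≡⟨ ∑-δ resp x ⟩
    f x                                            ∎

  -- Prepending x ≼ y to the multichain y ∷ c adds a new element exactly when x ≉ y.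
  distinct-step : ∀ {f} → Respects f → ∀ x y c →
    𝟙 (mc (x ∷ y ∷ c)) * distinctSum f (x ∷ y ∷ c)
      ≡ 𝟙 (leq? P x y) * (𝟙 (mc (y ∷ c)) * distinctSum f (y ∷ c))
        + f x * (𝟙 (lt? x y) * 𝟙 (mc (y ∷ c)))
  distinct-step {f} resp x y c with leq? P x y in x≼y | mc (y ∷ c) in mc-yc
  ... | true  | true  = begin
    1 * distinctSum f (x ∷ y ∷ c)
      ≡⟨ ℕ.*-identityˡ _ ⟩
    distinctSum f (x ∷ y ∷ c)
      ≡⟨ distinctSum-∷ resp x (y ∷ c) ⟩
    distinctSum f (y ∷ c) + 𝟙 (not (pt x (y ∷ c))) * f x
      ≡⟨ ≡.cong (λ b → distinctSum f (y ∷ c) + 𝟙 (not b) * f x)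
                (passesThrough-head c (Equivalence.from T-≡ x≼y) (Equivalence.from T-≡ mc-yc)) ⟩
    distinctSum f (y ∷ c) + 𝟙 (not (eq? P x y)) * f x
      ≡⟨ arith (distinctSum f (y ∷ c)) (𝟙 (not (eq? P x y))) (f x) ⟩
    1 * (1 * distinctSum f (y ∷ c)) + f x * (𝟙 (not (eq? P x y)) * 1)
      ∎
    where
    arith : ∀ s b v → s + b * v ≡ 1 * (1 * s) + v * (b * 1)
    arith = solve-∀
  ... | true  | false = arith (distinctSum f (y ∷ c)) (𝟙 (not (eq? P x y))) (f x)
    where
    arith : ∀ s b v → 0 ≡ 1 * (0 * s) + v * (b * 0)
    arith = solve-∀
  ... | false | b     = arith (𝟙 b) (distinctSum f (y ∷ c)) (f x)
    where
    arith : ∀ m s v → 0 ≡ 0 * (m * s) + v * (0 * m)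
    arith = solve-∀

  distinct-suc : ∀ {f} → Respects f → ∀ j x → distinct f (suc j) x ≡ up (distinct f j) x + f x * up⁺ (chainsFrom j) x
  distinct-suc {f} resp j x = begin
    distinct f (suc j) x
      ≡⟨ ∑-seqs-suc j _ ⟩
    ∑[ y ∈ E ] ∑[ c ∈ seqs P j ] 𝟙 (mc (x ∷ y ∷ c)) * distinctSum f (x ∷ y ∷ c)
      ≡⟨ ∑-cong E (λ y → ≡.trans (∑-cong (seqs P j) (distinct-step resp x y)) (∑-distrib-+ (seqs P j) _ _)) ⟩
    ∑[ y ∈ E ] (old y + new y)
      ≡⟨ ∑-distrib-+ E old new ⟩
    ∑ E old + ∑ E new
      ≡⟨ ≡.cong₂ _+_ (∑-cong E (λ y → *-distribˡ-∑ (𝟙 (leq? P x y)) (seqs P j) _))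
                     (≡.trans (*-distribˡ-∑ (f x) E _) (∑-cong E new≡)) ⟨
    up (distinct f j) x + f x * up⁺ (chainsFrom j) x
      ∎
    where
    old new : C → ℕ
    old y = ∑[ c ∈ seqs P j ] 𝟙 (leq? P x y) * (𝟙 (mc (y ∷ c)) * distinctSum f (y ∷ c))
    new y = ∑[ c ∈ seqs P j ] f x * (𝟙 (lt? x y) * 𝟙 (mc (y ∷ c)))
    new≡ : ∀ y → f x * (𝟙 (lt? x y) * chainsFrom j y) ≡ new y
    new≡ y = ≡.trans (≡.cong (f x *_) (*-distribˡ-∑ (𝟙 (lt? x y)) (seqs P j) _))
                     (*-distribˡ-∑ (f x) (seqs P j) _)

  -- positional f m x sums f over all entries, with repetitions, of all multichains x = y₁ ≤ ⋯ ≤ y_m.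
  positional : (C → ℕ) → ℕ → C → ℕ
  positional f zero    x = 0
  positional f (suc j) x = f x * up^ j (λ _ → 1) x + up (positional f j) x

  distinct+positional : ∀ {f} → Respects f → ∀ j x → distinct f j x + positional f j x ≡ positional f (suc j) x
  distinct+positional {f} resp zero x = begin
    distinct f 0 x + 0               ≡⟨ ℕ.+-identityʳ _ ⟩
    distinct f 0 x                   ≡⟨ distinct-zero resp x ⟩
    f x                              ≡⟨ ℕ.*-identityʳ (f x) ⟨
    f x * 1                          ≡⟨ ℕ.+-identityʳ _ ⟨
    f x * 1 + 0                      ≡⟨ ≡.cong (f x * 1 +_) (kernel-zero (leq? P) x) ⟨
    f x * 1 + up (λ _ → 0) x         ∎
  distinct+positional {f} resp (suc j) x = begin
    distinct f (suc j) x + positional f (suc j) x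
      ≡⟨ ≡.cong (_+ positional f (suc j) x) (distinct-suc resp j x) ⟩
    (up (distinct f j) x + f x * up⁺ (chainsFrom j) x) + (f x * N x + up (positional f j) x)
      ≡⟨ arith (up (distinct f j) x) (f x) (up⁺ (chainsFrom j) x) (N x) (up (positional f j) x) ⟩
    f x * (N x + up⁺ (chainsFrom j) x) + (up (distinct f j) x + up (positional f j) x)
      ≡⟨ ≡.cong₂ _+_ (≡.cong (f x *_) N-step) (kernel-distrib-+ (leq? P) _ _ x) ⟨
    f x * up N x + up (λ y → distinct f j y + positional f j y) x
      ≡⟨ ≡.cong (f x * up N x +_) (kernel-cong (leq? P) (distinct+positional resp j) x) ⟩
    positional f (suc (suc j)) x
      ∎
    where
    N : C → ℕ
    N = up^ j (λ _ → 1)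
    arith : ∀ d v u n q → (d + v * u) + (v * n + q) ≡ v * (n + u) + (d + q)
    arith = solve-∀
    N-step : up N x ≡ N x + up⁺ (chainsFrom j) x
    N-step = ≡.trans (up-split (up^-resp j) x) (≡.cong (N x +_) (kernel-cong lt? (λ y → ≡.sym (chainsFrom≡up^ j y)) x))

  positional-antidiagonal : ∀ f j x →
    positional f (suc j) x ≡ antidiagonal (λ r s → up^ r (λ y → f y * up^ s (λ _ → 1) y) x) j
  positional-antidiagonal f zero    x = ≡.trans (≡.cong (f x * 1 +_) (kernel-zero (leq? P) x)) (ℕ.+-identityʳ _)
  positional-antidiagonal f (suc j) x = ≡.cong (f x * up^ (suc j) (λ _ → 1) x +_)
    (≡.trans (kernel-cong (leq? P) (positional-antidiagonal f j) x) (kernel-antidiagonal (leq? P) j _ x))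

  -- visits m y is V_m(y): a multichain of length m with y at index r + 1 is a multichain of length
  -- r + 1 ending at y glued to one of length s + 1 starting at y, where r + s = m − 1.
  visits : ℕ → C → ℕ
  visits zero    y = 0
  visits (suc j) y = antidiagonal (λ r s → down^ r (λ _ → 1) y * up^ s (λ _ → 1) y) j

  ∑-positional : ∀ f m → ∑ E (positional f m) ≡ ∑[ y ∈ E ] f y * visits m y
  ∑-positional f zero = ≡.trans (∑-zero E) (≡.sym (≡.trans (∑-cong E (λ y → ℕ.*-zeroʳ (f y))) (∑-zero E)))
  ∑-positional f (suc j) = begin
    ∑ E (positional f (suc j))
      ≡⟨ ∑-cong E (positional-antidiagonal f j) ⟩
    ∑[ x ∈ E ] antidiagonal (λ r s → up^ r (g s) x) j
      ≡⟨ ∑-antidiagonal E j _ ⟩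
    antidiagonal (λ r s → ∑ E (up^ r (g s))) j
      ≡⟨ antidiagonal-cong j (λ r s → ≡.trans (∑-kernel^ (leq? P) r (g s))
           (∑-cong E (λ y → x*yz≡y*xz (down^ r (λ _ → 1) y) (f y) (up^ s (λ _ → 1) y)))) ⟩
    antidiagonal (λ r s → ∑[ y ∈ E ] f y * (down^ r (λ _ → 1) y * up^ s (λ _ → 1) y)) j
      ≡⟨ ∑-antidiagonal E j _ ⟨
    ∑[ y ∈ E ] antidiagonal (λ r s → f y * (down^ r (λ _ → 1) y * up^ s (λ _ → 1) y)) j
      ≡⟨ ∑-cong E (λ y → *-distribˡ-antidiagonal (f y) j _) ⟨
    ∑[ y ∈ E ] f y * visits (suc j) y
      ∎
    where
    g : ℕ → C → ℕ
    g s y = f y * up^ s (λ _ → 1) y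

  ∑-*-multichainsThrough+visits : ∀ {f} → Respects f → ∀ j →
    (∑[ p ∈ E ] f p * multichainsThrough P (suc j) p) + (∑[ y ∈ E ] f y * visits j y)
      ≡ ∑[ y ∈ E ] f y * visits (suc j) y
  ∑-*-multichainsThrough+visits {f} resp j = begin
    (∑[ p ∈ E ] f p * multichainsThrough P (suc j) p) + (∑[ y ∈ E ] f y * visits j y)
      ≡⟨ ≡.cong₂ _+_ (∑-*-multichainsThrough f j) (≡.sym (∑-positional f j)) ⟩
    ∑ E (distinct f j) + ∑ E (positional f j)
      ≡⟨ ∑-distrib-+ E _ _ ⟨
    ∑[ x ∈ E ] (distinct f j x + positional f j x)
      ≡⟨ ∑-cong E (distinct+positional resp j) ⟩
    ∑ E (positional f (suc j))
      ≡⟨ ∑-positional f (suc j) ⟩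
    ∑[ y ∈ E ] f y * visits (suc j) y
      ∎

  pushforward-uniform : ∀ {a} (π : C → Fin a) → (∀ {y y′} → y ≈ y′ → π y ≡ π y′) →
    (∀ m i i′ → pushforward P π (visits m) i ≡ pushforward P π (visits m) i′) →
    ∀ j i i′ → pushforward P π (multichainsThrough P (suc j)) i ≡ pushforward P π (multichainsThrough P (suc j)) i′
  pushforward-uniform π π-resp visits-uniform j i i′ = ℕ.+-cancelʳ-≡ (V j i) _ _ (begin
    W i + V j i    ≡⟨ ∑-*-multichainsThrough+visits (fiber-resp i) j ⟩
    V (suc j) i    ≡⟨ visits-uniform (suc j) i i′ ⟩
    V (suc j) i′   ≡⟨ ∑-*-multichainsThrough+visits (fiber-resp i′) j ⟨
    W i′ + V j i′  ≡⟨ ≡.cong (W i′ +_) (visits-uniform j i i′) ⟨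
    W i′ + V j i   ∎)
    where
    W : Fin _ → ℕ
    W = pushforward P π (multichainsThrough P (suc j))
    V : ℕ → Fin _ → ℕ
    V m = pushforward P π (visits m)
    fiber-resp : ∀ i → Respects (λ y → 𝟙 ⌊ π y Fin.≟ i ⌋)
    fiber-resp i y≈y′ = ≡.cong (λ z → 𝟙 ⌊ z Fin.≟ i ⌋) (π-resp y≈y′)

𝟙-≤-suc : ∀ x y → 𝟙 ⌊ x ℕ.≤? suc y ⌋ ≡ 𝟙 ⌊ x ℕ.≤? y ⌋ + 𝟙 ⌊ x ℕ.≟ suc y ⌋
𝟙-≤-suc x y with ℕ.<-cmp x (suc y)
... | tri< x<1+y x≢1+y _
  rewrite ⌊⌋-yes (x ℕ.≤? suc y) (ℕ.<⇒≤ x<1+y) | ⌊⌋-yes (x ℕ.≤? y) (s≤s⁻¹ x<1+y)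
        | ⌊⌋-no (x ℕ.≟ suc y) x≢1+y = ≡.refl
... | tri≈ _ ≡.refl _
  rewrite ⌊⌋-yes (suc y ℕ.≤? suc y) ℕ.≤-refl | ⌊⌋-no (suc y ℕ.≤? y) ℕ.1+n≰n
        | ⌊⌋-yes (suc y ℕ.≟ suc y) ≡.refl = ≡.refl
... | tri> _ x≢1+y 1+y<x
  rewrite ⌊⌋-no (x ℕ.≤? suc y) (ℕ.<⇒≱ 1+y<x)
        | ⌊⌋-no (x ℕ.≤? y) (λ x≤y → ℕ.<⇒≱ 1+y<x (ℕ.m≤n⇒m≤1+n x≤y))
        | ⌊⌋-no (x ℕ.≟ suc y) x≢1+y = ≡.refl

𝟙-≤-split : ∀ y x → 𝟙 ⌊ y ℕ.≤? x ⌋ ≡ 𝟙 ⌊ x ℕ.≟ y ⌋ + 𝟙 ⌊ suc y ℕ.≤? x ⌋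
𝟙-≤-split y x with ℕ.<-cmp y x
... | tri< y<x y≢x _
  rewrite ⌊⌋-yes (y ℕ.≤? x) (ℕ.<⇒≤ y<x) | ⌊⌋-no (x ℕ.≟ y) (y≢x ∘ ≡.sym)
        | ⌊⌋-yes (suc y ℕ.≤? x) y<x = ≡.refl
... | tri≈ _ ≡.refl _
  rewrite ⌊⌋-yes (y ℕ.≤? y) ℕ.≤-refl | ⌊⌋-yes (y ℕ.≟ y) ≡.refl
        | ⌊⌋-no (suc y ℕ.≤? y) ℕ.1+n≰n = ≡.refl
... | tri> _ y≢x x<y
  rewrite ⌊⌋-no (y ℕ.≤? x) (ℕ.<⇒≱ x<y) | ⌊⌋-no (x ℕ.≟ y) (y≢x ∘ ≡.sym)
        | ⌊⌋-no (suc y ℕ.≤? x) (λ y<x → ℕ.<-asym y<x x<y) = ≡.refl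

module Interval (a : ℕ) where
  open ≡-Reasoning

  ∑< : (ℕ → ℕ) → ℕ
  ∑< h = ∑[ x ∈ allFin a ] h (toℕ x)

  upℕ downℕ : (ℕ → ℕ) → ℕ → ℕ
  upℕ   h y = ∑< (λ x → 𝟙 ⌊ y ℕ.≤? x ⌋ * h x)
  downℕ h y = ∑< (λ x → 𝟙 ⌊ x ℕ.≤? y ⌋ * h x)

  upℕ^ downℕ^ : ℕ → (ℕ → ℕ) → ℕ → ℕ
  upℕ^   r h = fold h upℕ r
  downℕ^ r h = fold h downℕ r

  visitsℕ : ℕ → ℕ → ℕ
  visitsℕ zero    z = 0
  visitsℕ (suc j) z = antidiagonal (λ r s → downℕ^ r (λ _ → 1) z * upℕ^ s (λ _ → 1) z) j

  ∑<-δ : ∀ h {z} → z < a → ∑< (λ x → 𝟙 ⌊ x ℕ.≟ z ⌋ * h x) ≡ h z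
  ∑<-δ h {z} z<a = begin
    ∑[ x ∈ allFin a ] 𝟙 ⌊ toℕ x ℕ.≟ z ⌋ * h (toℕ x)
      ≡⟨ ∑-cong (allFin a) (λ x →
           ≡.cong (λ b → 𝟙 b * h (toℕ x)) (⌊⌋-⇔ toℕ≡⇔ (toℕ x ℕ.≟ z) (x Fin.≟ i))) ⟩
    ∑[ x ∈ allFin a ] 𝟙 ⌊ x Fin.≟ i ⌋ * h (toℕ x)
      ≡⟨ ∑-allFin-δ i (h ∘ toℕ) ⟩
    h (toℕ i)
      ≡⟨ ≡.cong h (Fin.toℕ-fromℕ< z<a) ⟩
    h z
      ∎
    where
    i : Fin a
    i = fromℕ< z<a
    toℕ≡⇔ : ∀ {x} → toℕ x ≡ z ⇔ x ≡ i
    toℕ≡⇔ = mk⇔ (λ e → Fin.toℕ-injective (≡.trans e (≡.sym (Fin.toℕ-fromℕ< z<a))))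
                (λ e → ≡.trans (≡.cong toℕ e) (Fin.toℕ-fromℕ< z<a))

  downℕ-suc : ∀ h {y} → suc y < a → downℕ h (suc y) ≡ downℕ h y + h (suc y)
  downℕ-suc h {y} 1+y<a = begin
    ∑< (λ x → 𝟙 ⌊ x ℕ.≤? suc y ⌋ * h x)
      ≡⟨ ∑-cong (allFin a) (λ x → ≡.trans (≡.cong (_* h (toℕ x)) (𝟙-≤-suc (toℕ x) y))
           (ℕ.*-distribʳ-+ (h (toℕ x)) (𝟙 ⌊ toℕ x ℕ.≤? y ⌋) (𝟙 ⌊ toℕ x ℕ.≟ suc y ⌋))) ⟩
    ∑< (λ x → 𝟙 ⌊ x ℕ.≤? y ⌋ * h x + 𝟙 ⌊ x ℕ.≟ suc y ⌋ * h x)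
      ≡⟨ ∑-distrib-+ (allFin a) _ _ ⟩
    downℕ h y + ∑< (λ x → 𝟙 ⌊ x ℕ.≟ suc y ⌋ * h x)
      ≡⟨ ≡.cong (downℕ h y +_) (∑<-δ h 1+y<a) ⟩
    downℕ h y + h (suc y)
      ∎

  upℕ-split : ∀ h {y} → y < a → upℕ h y ≡ h y + upℕ h (suc y)
  upℕ-split h {y} y<a = begin
    ∑< (λ x → 𝟙 ⌊ y ℕ.≤? x ⌋ * h x)
      ≡⟨ ∑-cong (allFin a) (λ x → ≡.trans (≡.cong (_* h (toℕ x)) (𝟙-≤-split y (toℕ x)))
           (ℕ.*-distribʳ-+ (h (toℕ x)) (𝟙 ⌊ toℕ x ℕ.≟ y ⌋) (𝟙 ⌊ suc y ℕ.≤? toℕ x ⌋))) ⟩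
    ∑< (λ x → 𝟙 ⌊ x ℕ.≟ y ⌋ * h x + 𝟙 ⌊ suc y ℕ.≤? x ⌋ * h x)
      ≡⟨ ∑-distrib-+ (allFin a) _ _ ⟩
    ∑< (λ x → 𝟙 ⌊ x ℕ.≟ y ⌋ * h x) + upℕ h (suc y)
      ≡⟨ ≡.cong (_+ upℕ h (suc y)) (∑<-δ h y<a) ⟩
    h y + upℕ h (suc y)
      ∎

  -- Both sides are compared with the mixed sum Σ_{r+s=j+1} D r (z+1) · U s z, peeling off its
  -- first term with downℕ-suc and its last term with upℕ-split.
  visitsℕ-suc : ∀ m {z} → suc z < a → visitsℕ m (suc z) ≡ visitsℕ m z
  visitsℕ-suc zero          _     = ≡.refl
  visitsℕ-suc (suc zero)    _     = ≡.refl
  visitsℕ-suc (suc (suc j)) {z} 1+z<a =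
    ℕ.+-cancelʳ-≡ (antidiagonal mixed j) _ _ (≡.trans (≡.sym via-last) via-first)
    where
    D U : ℕ → ℕ → ℕ
    D r = downℕ^ r (λ _ → 1)
    U s = upℕ^ s (λ _ → 1)
    mixed : ℕ → ℕ → ℕ
    mixed r s = D r (suc z) * U s z
    arith : ∀ p m q → p + (m + q) ≡ (p + q) + m
    arith = solve-∀

    via-first : antidiagonal mixed (suc j) ≡ visitsℕ (2 + j) z + antidiagonal mixed j
    via-first = begin
      mixed 0 (suc j) + antidiagonal (λ r s → mixed (suc r) s) j
        ≡⟨ ≡.cong (mixed 0 (suc j) +_) (antidiagonal-cong j (λ r s →
             ≡.trans (≡.cong (_* U s z) (downℕ-suc (D r) 1+z<a)) (ℕ.*-distribʳ-+ (U s z) (D (suc r) z) (D r (suc z))))) ⟩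
      mixed 0 (suc j) + antidiagonal (λ r s → D (suc r) z * U s z + mixed r s) j
        ≡⟨ ≡.cong (mixed 0 (suc j) +_) (antidiagonal-distrib-+ j _ _) ⟩
      mixed 0 (suc j) + (antidiagonal (λ r s → D (suc r) z * U s z) j + antidiagonal mixed j)
        ≡⟨ ℕ.+-assoc (mixed 0 (suc j)) _ _ ⟨
      visitsℕ (2 + j) z + antidiagonal mixed j
        ∎

    via-last : antidiagonal mixed (suc j) ≡ visitsℕ (2 + j) (suc z) + antidiagonal mixed j
    via-last = begin
      antidiagonal mixed (suc j)
        ≡⟨ antidiagonal-suc-last j mixed ⟩
      mixed (suc j) 0 + antidiagonal (λ r s → mixed r (suc s)) j
        ≡⟨ ≡.cong (mixed (suc j) 0 +_) (antidiagonal-cong j (λ r s →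
             ≡.trans (≡.cong (D r (suc z) *_) (upℕ-split (U s) (ℕ.<⇒≤ 1+z<a)))
                     (ℕ.*-distribˡ-+ (D r (suc z)) (U s z) (U (suc s) (suc z))))) ⟩
      mixed (suc j) 0 + antidiagonal (λ r s → mixed r s + D r (suc z) * U (suc s) (suc z)) j
        ≡⟨ ≡.cong (mixed (suc j) 0 +_) (antidiagonal-distrib-+ j _ _) ⟩
      mixed (suc j) 0 + (antidiagonal mixed j + antidiagonal (λ r s → D r (suc z) * U (suc s) (suc z)) j)
        ≡⟨ arith (mixed (suc j) 0) _ _ ⟩
      (mixed (suc j) 0 + antidiagonal (λ r s → D r (suc z) * U (suc s) (suc z)) j) + antidiagonal mixed j
        ≡⟨ ≡.cong (_+ antidiagonal mixed j) (antidiagonal-suc-last j (λ r s → D r (suc z) * U s (suc z))) ⟨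
      visitsℕ (2 + j) (suc z) + antidiagonal mixed j
        ∎

  visitsℕ-const : ∀ m {z} → z < a → visitsℕ m z ≡ visitsℕ m 0
  visitsℕ-const m {zero}  _   = ≡.refl
  visitsℕ-const m {suc z} z<a = ≡.trans (visitsℕ-suc m z<a) (visitsℕ-const m (ℕ.<⇒≤ z<a))

chain-isFinPoset : ∀ a → IsFinPoset (chain a)
chain-isFinPoset a = record
  { ≼-refl          = λ x → fromWitness (Fin.≤-refl {x = x})
  ; ≼-trans         = λ {x} {y} {z} x≤y y≤z →
      fromWitness (Fin.≤-trans (toWitness {a? = x Fin.≤? y} x≤y) (toWitness {a? = y Fin.≤? z} y≤z))
  ; ≈⇔≼∧≽           = λ {x} {y} → mk⇔
      (λ x≡y → fromWitness (Fin.≤-reflexive (toWitness {a? = x Fin.≟ y} x≡y))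
             , fromWitness (Fin.≤-reflexive (≡.sym (toWitness {a? = x Fin.≟ y} x≡y))))
      (λ (x≤y , y≤x) → fromWitness (Fin.≤-antisym (toWitness {a? = x Fin.≤? y} x≤y) (toWitness {a? = y Fin.≤? x} y≤x)))
  ; enumerates-once = λ x → ≡.trans (∑-cong (allFin a) (λ y → ≡.sym (ℕ.*-identityʳ _))) (∑-allFin-δ x (λ _ → 1))
  }

module ChainMarginal (a : ℕ) where
  open Multichains (chain-isFinPoset a)
  open Interval a

  -- Fin._≤?_ is ℕ._≤?_ on toℕ, so the kernels of chain a are those of Interval a by definition.
  up^-toℕ : ∀ r g x → up^ r (g ∘ toℕ) x ≡ upℕ^ r g (toℕ x)
  up^-toℕ zero    g x = ≡.refl
  up^-toℕ (suc r) g x = kernel-cong (leq? (chain a)) (up^-toℕ r g) x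

  down^-toℕ : ∀ r g x → down^ r (g ∘ toℕ) x ≡ downℕ^ r g (toℕ x)
  down^-toℕ zero    g x = ≡.refl
  down^-toℕ (suc r) g x = kernel-cong (flip (leq? (chain a))) (down^-toℕ r g) x

  visits-uniform : ∀ m i i′ → visits m i ≡ visits m i′
  visits-uniform m i i′ = ≡.trans (visits-toℕ m i) (≡.trans (visitsℕ-const m (Fin.toℕ<n i))
                                  (≡.sym (≡.trans (visits-toℕ m i′) (visitsℕ-const m (Fin.toℕ<n i′)))))
    where
    visits-toℕ : ∀ m i → visits m i ≡ visitsℕ m (toℕ i)
    visits-toℕ zero    i = ≡.refl
    visits-toℕ (suc j) i = antidiagonal-cong j (λ r s →
      ≡.cong₂ _*_ (down^-toℕ r (λ _ → 1) i) (up^-toℕ s (λ _ → 1) i))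

  multichainsThrough-uniform : ∀ j i i′ →
    pushforward (chain a) (λ y → y) (multichainsThrough (chain a) (suc j)) i
      ≡ pushforward (chain a) (λ y → y) (multichainsThrough (chain a) (suc j)) i′
  multichainsThrough-uniform = pushforward-uniform (λ y → y) (λ {y} {y′} → toWitness {a? = y Fin.≟ y′})
    (λ m i i′ → ≡.trans (∑-allFin-δ i (visits m)) (≡.trans (visits-uniform m i i′) (≡.sym (∑-allFin-δ i′ (visits m)))))

tensor : ∀ {n} {a : Fin n → ℕ} → ((l : Fin n) → Fin (a l) → ℕ) → Tuple n a → ℕ
tensor h y = ∏ (λ l → h l (y l))

module _ where
  open ≡-Reasoning

  ∑-allTuples-suc : ∀ {n} (a : Fin (suc n) → ℕ) (F : Tuple (suc n) a → ℕ) →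
    ∑ (allTuples (suc n) a) F ≡ ∑[ i ∈ allFin (a zero) ] ∑[ t ∈ allTuples n (a ∘ suc) ] F (consT i t)
  ∑-allTuples-suc {n} a F = ≡.trans (∑-concatMap _ (allFin (a zero)) F)
    (∑-cong (allFin (a zero)) (λ i → ∑-map (consT {n} {a} i) (allTuples n (a ∘ suc)) F))

  ∑-tensor : ∀ n (a : Fin n → ℕ) h → ∑ (allTuples n a) (tensor h) ≡ ∏ (λ l → ∑ (allFin (a l)) (h l))
  ∑-tensor zero    a h = ≡.refl
  ∑-tensor (suc n) a h = begin
    ∑ (allTuples (suc n) a) (tensor h)
      ≡⟨ ∑-allTuples-suc a (tensor h) ⟩
    ∑[ i ∈ allFin (a zero) ] ∑[ t ∈ allTuples n (a ∘ suc) ] h zero i * tensor h₊ t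
      ≡⟨ ∑-cong (allFin (a zero)) (λ i → *-distribˡ-∑ (h zero i) (allTuples n (a ∘ suc)) (tensor h₊)) ⟨
    ∑[ i ∈ allFin (a zero) ] h zero i * ∑ (allTuples n (a ∘ suc)) (tensor h₊)
      ≡⟨ *-distribʳ-∑ _ (allFin (a zero)) (h zero) ⟨
    ∑ (allFin (a zero)) (h zero) * ∑ (allTuples n (a ∘ suc)) (tensor h₊)
      ≡⟨ ≡.cong (∑ (allFin (a zero)) (h zero) *_) (∑-tensor n (a ∘ suc) h₊) ⟩
    ∏ (λ l → ∑ (allFin (a l)) (h l))
      ∎
    where
    h₊ : (l : Fin n) → Fin (a (suc l)) → ℕ
    h₊ l = h (suc l)

  ∑-tensor-fiber : ∀ {n} (a : Fin (suc n) → ℕ) h (k : Fin (suc n)) (i : Fin (a k)) →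
    ∑[ y ∈ allTuples (suc n) a ] 𝟙 ⌊ y k Fin.≟ i ⌋ * tensor h y
      ≡ h k i * ∏ (removeAt (λ l → ∑ (allFin (a l)) (h l)) k)
  ∑-tensor-fiber {n} a h zero i = begin
    ∑[ y ∈ allTuples (suc n) a ] 𝟙 ⌊ y zero Fin.≟ i ⌋ * tensor h y
      ≡⟨ ∑-allTuples-suc a _ ⟩
    ∑[ i₀ ∈ allFin (a zero) ] ∑[ t ∈ allTuples n (a ∘ suc) ] 𝟙 ⌊ i₀ Fin.≟ i ⌋ * (h zero i₀ * tensor h₊ t)
      ≡⟨ ∑-cong (allFin (a zero)) (λ i₀ → ≡.trans
           (≡.cong (𝟙 ⌊ i₀ Fin.≟ i ⌋ *_) (*-distribˡ-∑ (h zero i₀) (allTuples n (a ∘ suc)) (tensor h₊)))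
           (*-distribˡ-∑ (𝟙 ⌊ i₀ Fin.≟ i ⌋) (allTuples n (a ∘ suc)) (λ t → h zero i₀ * tensor h₊ t))) ⟨
    ∑[ i₀ ∈ allFin (a zero) ] 𝟙 ⌊ i₀ Fin.≟ i ⌋ * (h zero i₀ * ∑ (allTuples n (a ∘ suc)) (tensor h₊))
      ≡⟨ ∑-allFin-δ i (λ i₀ → h zero i₀ * ∑ (allTuples n (a ∘ suc)) (tensor h₊)) ⟩
    h zero i * ∑ (allTuples n (a ∘ suc)) (tensor h₊)
      ≡⟨ ≡.cong (h zero i *_) (∑-tensor n (a ∘ suc) h₊) ⟩
    h zero i * ∏ (λ l → ∑ (allFin (a (suc l))) (h₊ l))
      ∎
    where
    h₊ : (l : Fin n) → Fin (a (suc l)) → ℕ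
    h₊ l = h (suc l)
  ∑-tensor-fiber {suc n} a h (suc k) i = begin
    ∑[ y ∈ allTuples (2 + n) a ] 𝟙 ⌊ y (suc k) Fin.≟ i ⌋ * tensor h y
      ≡⟨ ∑-allTuples-suc a _ ⟩
    ∑[ i₀ ∈ allFin (a zero) ] ∑[ t ∈ allTuples (suc n) (a ∘ suc) ] 𝟙 ⌊ t k Fin.≟ i ⌋ * (h zero i₀ * tensor h₊ t)
      ≡⟨ ∑-cong (allFin (a zero)) (λ i₀ → ≡.trans
           (∑-cong (allTuples (suc n) (a ∘ suc)) (λ t → x*yz≡y*xz (𝟙 ⌊ t k Fin.≟ i ⌋) (h zero i₀) (tensor h₊ t)))
           (≡.sym (*-distribˡ-∑ (h zero i₀) (allTuples (suc n) (a ∘ suc)) _))) ⟩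
    ∑[ i₀ ∈ allFin (a zero) ] h zero i₀ * (∑[ t ∈ allTuples (suc n) (a ∘ suc) ] 𝟙 ⌊ t k Fin.≟ i ⌋ * tensor h₊ t)
      ≡⟨ ∑-cong (allFin (a zero)) (λ i₀ → ≡.cong (h zero i₀ *_) (∑-tensor-fiber (a ∘ suc) h₊ k i)) ⟩
    ∑[ i₀ ∈ allFin (a zero) ] h zero i₀ * (h (suc k) i * rest)
      ≡⟨ *-distribʳ-∑ _ (allFin (a zero)) (h zero) ⟨
    ∑ (allFin (a zero)) (h zero) * (h (suc k) i * rest)
      ≡⟨ x*yz≡y*xz (∑ (allFin (a zero)) (h zero)) (h (suc k) i) rest ⟩
    h (suc k) i * (∑ (allFin (a zero)) (h zero) * rest)
      ∎
    where
    h₊ : (l : Fin (suc n)) → Fin (a (suc l)) → ℕ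
    h₊ l = h (suc l)
    rest : ℕ
    rest = ∏ (removeAt (λ l → ∑ (allFin (a (suc l))) (h₊ l)) k)

𝟙-all? : ∀ {n} {Q : Fin n → Set} (Q? : ∀ k → Dec (Q k)) → 𝟙 ⌊ Fin.all? Q? ⌋ ≡ ∏ (λ k → 𝟙 ⌊ Q? k ⌋)
𝟙-all? {zero}      Q? = ≡.cong 𝟙 (⌊⌋-yes (Fin.all? Q?) (λ ()))
𝟙-all? {suc n} {Q} Q? = ≡.trans (≡.cong 𝟙 all?-suc)
  (≡.trans (𝟙-∧ ⌊ Q? zero ⌋ ⌊ Fin.all? (Q? ∘ suc) ⌋) (≡.cong (𝟙 ⌊ Q? zero ⌋ *_) (𝟙-all? (Q? ∘ suc))))
  where
  all?-suc : ⌊ Fin.all? Q? ⌋ ≡ ⌊ Q? zero ⌋ ∧ ⌊ Fin.all? (Q? ∘ suc) ⌋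
  all?-suc = T-injective
    (λ all → let ∀Q = toWitness {a? = Fin.all? Q?} all in
      Equivalence.from T-∧ (fromWitness {a? = Q? zero} (∀Q zero) , fromWitness {a? = Fin.all? (Q? ∘ suc)} (∀Q ∘ suc)))
    (λ both → let Q₀ , Q₊ = Equivalence.to T-∧ both in
      fromWitness {a? = Fin.all? Q?} λ { zero    → toWitness {a? = Q? zero} Q₀
                                       ; (suc k) → toWitness {a? = Fin.all? (Q? ∘ suc)} Q₊ k })

module _ {n : ℕ} {a : Fin n → ℕ} (R : Tuple n a → Tuple n a → Bool) (Rₗ : ∀ l → Fin (a l) → Fin (a l) → Bool)
         (factorises : ∀ x y → 𝟙 (R x y) ≡ ∏ (λ l → 𝟙 (Rₗ l (x l) (y l)))) where
  open Kernel (allTuples n a)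

  kernel-tensor : ∀ h x → kernel R (tensor h) x ≡ tensor (λ l → Kernel.kernel (allFin (a l)) (Rₗ l) (h l)) x
  kernel-tensor h x = ≡.trans
    (∑-cong (allTuples n a) (λ y → ≡.trans (≡.cong (_* tensor h y) (factorises x y))
                                           (≡.sym (∏-distrib-* (λ l → 𝟙 (Rₗ l (x l) (y l))) (λ l → h l (y l))))))
    (∑-tensor n a (λ l z → 𝟙 (Rₗ l (x l) z) * h l z))

  kernel^-tensor : ∀ r h x → kernel^ R r (tensor h) x ≡ tensor (λ l → Kernel.kernel^ (allFin (a l)) (Rₗ l) r (h l)) x
  kernel^-tensor zero    h x = ≡.refl
  kernel^-tensor (suc r) h x = ≡.trans (kernel-cong R (kernel^-tensor r h) x) (kernel-tensor _ x)

productPoset-isFinPoset : ∀ n a → IsFinPoset (productPoset n a)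
productPoset-isFinPoset n a = record
  { ≼-refl          = λ x → fromWitness (λ k → Fin.≤-refl)
  ; ≼-trans         = λ {x} {y} {z} x≤y y≤z → fromWitness (λ k →
      Fin.≤-trans (toWitness {a? = ≤? x y} x≤y k) (toWitness {a? = ≤? y z} y≤z k))
  ; ≈⇔≼∧≽           = λ {x} {y} → mk⇔
      (λ x≡y → fromWitness (λ k → Fin.≤-reflexive (toWitness {a? = ≟ x y} x≡y k))
             , fromWitness (λ k → Fin.≤-reflexive (≡.sym (toWitness {a? = ≟ x y} x≡y k))))
      (λ (x≤y , y≤x) → fromWitness (λ k →
         Fin.≤-antisym (toWitness {a? = ≤? x y} x≤y k) (toWitness {a? = ≤? y x} y≤x k)))
  ; enumerates-once = λ x → begin
      ∑[ y ∈ allTuples n a ] 𝟙 ⌊ ≟ y x ⌋                    ≡⟨ ∑-cong (allTuples n a) (λ y → 𝟙-all? _) ⟩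
      ∑ (allTuples n a) (tensor (λ l z → 𝟙 ⌊ z Fin.≟ x l ⌋))  ≡⟨ ∑-tensor n a _ ⟩
      ∏ (λ l → ∑[ z ∈ allFin (a l) ] 𝟙 ⌊ z Fin.≟ x l ⌋)       ≡⟨ ∏-cong (λ l →
                                                                  IsFinPoset.enumerates-once (chain-isFinPoset (a l)) (x l)) ⟩
      ∏ {n} (λ _ → 1)                                        ≡⟨ ∏-ones n ⟩
      1                                                      ∎
  }
  where
  open ≡-Reasoning
  ≤? ≟ : (x y : Tuple n a) → Dec (∀ k → _)
  ≤? x y = Fin.all? (λ k → x k Fin.≤? y k)
  ≟  x y = Fin.all? (λ k → x k Fin.≟ y k)

module ProductMarginal {n : ℕ} (a : Fin (suc n) → ℕ) where
  open Multichains (productPoset-isFinPoset (suc n) a)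
  module Chain (l : Fin (suc n)) = Multichains (chain-isFinPoset (a l))
  open ≡-Reasoning

  private
    P : FinPoset
    P = productPoset (suc n) a

  ≼-factorises : ∀ x y → 𝟙 (leq? P x y) ≡ ∏ (λ l → 𝟙 (leq? (chain (a l)) (x l) (y l)))
  ≼-factorises x y = 𝟙-all? (λ k → x k Fin.≤? y k)

  up^-tensor : ∀ r x → up^ r (λ _ → 1) x ≡ tensor (λ l → Chain.up^ l r (λ _ → 1)) x
  up^-tensor r x = ≡.trans (kernel^-cong (leq? P) (λ _ → ≡.sym (∏-ones (suc n))) r x)
                           (kernel^-tensor (leq? P) (λ l → leq? (chain (a l))) ≼-factorises r (λ _ _ → 1) x)

  down^-tensor : ∀ r x → down^ r (λ _ → 1) x ≡ tensor (λ l → Chain.down^ l r (λ _ → 1)) x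
  down^-tensor r x = ≡.trans (kernel^-cong (flip (leq? P)) (λ _ → ≡.sym (∏-ones (suc n))) r x)
    (kernel^-tensor (flip (leq? P)) (λ l → flip (leq? (chain (a l)))) (flip ≼-factorises) r (λ _ _ → 1) x)

  ∑-down^*up^ : ∀ l r s → ∑[ z ∈ allFin (a l) ] Chain.down^ l r (λ _ → 1) z * Chain.up^ l s (λ _ → 1) z
                           ≡ ∑ (allFin (a l)) (Chain.up^ l (r + s) (λ _ → 1))
  ∑-down^*up^ l r s = ≡.sym (≡.trans (≡.cong (∑ (allFin (a l))) (fold-+ (λ _ → 1) (Chain.up l) r))
                                     (Chain.∑-kernel^ l (leq? (chain (a l))) r _))

  pushforward-visits : ∀ k j i → pushforward P (λ y → y k) (visits (suc j)) i
    ≡ Chain.visits k (suc j) i * ∏ (removeAt (λ l → ∑ (allFin (a l)) (Chain.up^ l j (λ _ → 1))) k)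
  pushforward-visits k j i = begin
    ∑[ y ∈ allTuples (suc n) a ] 𝟙 ⌊ y k Fin.≟ i ⌋ * visits (suc j) y
      ≡⟨ ∑-cong (allTuples (suc n) a) (λ y → ≡.trans (≡.cong (𝟙 ⌊ y k Fin.≟ i ⌋ *_) (visits-tensor y))
                      (*-distribˡ-antidiagonal (𝟙 ⌊ y k Fin.≟ i ⌋) j (λ r s → tensor (d r s) y))) ⟩
    ∑[ y ∈ allTuples (suc n) a ] antidiagonal (λ r s → 𝟙 ⌊ y k Fin.≟ i ⌋ * tensor (d r s) y) j
      ≡⟨ ∑-antidiagonal (allTuples (suc n) a) j _ ⟩
    antidiagonal (λ r s → ∑[ y ∈ allTuples (suc n) a ] 𝟙 ⌊ y k Fin.≟ i ⌋ * tensor (d r s) y) j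
      ≡⟨ antidiagonal-cong j (λ r s → ≡.trans (∑-tensor-fiber a (d r s) k i)
           (≡.cong (d r s k i *_) (∏-cong (λ l → ∑-down^*up^ (punchIn k l) r s)))) ⟩
    antidiagonal (λ r s → d r s k i * Q (r + s)) j
      ≡⟨ antidiagonal-*-diagonal j (λ r s → d r s k i) Q ⟩
    Chain.visits k (suc j) i * Q j
      ∎
    where
    D U : (l : Fin (suc n)) → ℕ → Fin (a l) → ℕ
    D l r = Chain.down^ l r (λ _ → 1)
    U l s = Chain.up^ l s (λ _ → 1)
    d : ℕ → ℕ → (l : Fin (suc n)) → Fin (a l) → ℕ
    d r s l z = D l r z * U l s z
    Q : ℕ → ℕ
    Q m = ∏ (removeAt (λ l → ∑ (allFin (a l)) (Chain.up^ l m (λ _ → 1))) k)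
    visits-tensor : ∀ y → visits (suc j) y ≡ antidiagonal (λ r s → tensor (d r s) y) j
    visits-tensor y = antidiagonal-cong j (λ r s → ≡.trans (≡.cong₂ _*_ (down^-tensor r y) (up^-tensor s y))
                                                           (≡.sym (∏-distrib-* (λ l → D l r (y l)) (λ l → U l s (y l)))))

  multichainsThrough-uniform : ∀ k j i i′ →
    pushforward P (λ y → y k) (multichainsThrough P (suc j)) i ≡ pushforward P (λ y → y k) (multichainsThrough P (suc j)) i′
  multichainsThrough-uniform k = pushforward-uniform (λ y → y k)
    (λ {y} {y′} y≈y′ → toWitness {a? = Fin.all? (λ l → y l Fin.≟ y′ l)} y≈y′ k) visits-uniform
    where
    visits-uniform : ∀ m i i′ → pushforward P (λ y → y k) (visits m) i ≡ pushforward P (λ y → y k) (visits m) i′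
    visits-uniform zero    i i′ = ≡.trans (∑-cong (allTuples (suc n) a) (λ y → ℕ.*-zeroʳ (𝟙 ⌊ y k Fin.≟ i ⌋)))
      (≡.sym (∑-cong (allTuples (suc n) a) (λ y → ℕ.*-zeroʳ (𝟙 ⌊ y k Fin.≟ i′ ⌋))))
    visits-uniform (suc j) i i′ = ≡.trans (pushforward-visits k j i)
      (≡.trans (≡.cong (_* _) (ChainMarginal.visits-uniform (a k) (suc j) i i′)) (≡.sym (pushforward-visits k j i′)))

∑-allFin-const : ∀ a c → ∑[ i ∈ allFin a ] c ≡ a * c
∑-allFin-const zero    c = ≡.refl
∑-allFin-const (suc a) c = ≡.trans (∑-allFin-suc a (λ _ → c)) (≡.cong (c +_) (∑-allFin-const a c))

open import Data.Integer as ℤ using (+_)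
import Data.Integer.Properties as ℤ
open import Data.Rational as ℚ using (ℚ; _/_; 0ℚ; toℚᵘ)
import Data.Rational.Properties as ℚ
open import Data.Rational.Unnormalised as ℚᵘ using (mkℚᵘ; *≡*)
import Data.Rational.Unnormalised.Properties as ℚᵘ

module ℚ∑ = ListSum (CommutativeRing.commutativeSemiring ℚ.+-*-commutativeRing)

ι : ℕ → ℚ
ι n = + n / 1

ι-+ : ∀ m n → ι (m + n) ≡ ι m ℚ.+ ι n
ι-+ m n = ℚ.toℚᵘ-injective (begin
  toℚᵘ (ι (m + n))                   ≈⟨ ℚ.toℚᵘ-fromℚᵘ (mkℚᵘ (+ (m + n)) 0) ⟩
  mkℚᵘ (+ (m + n)) 0                 ≈⟨ *≡* (≡.cong (ℤ._* + 1) (≡.trans (ℤ.pos-+ m n)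
                                          (≡.sym (≡.cong₂ ℤ._+_ (ℤ.*-identityʳ (+ m)) (ℤ.*-identityʳ (+ n)))))) ⟩
  mkℚᵘ (+ m) 0 ℚᵘ.+ mkℚᵘ (+ n) 0     ≈⟨ ℚᵘ.+-cong (ℚ.toℚᵘ-fromℚᵘ (mkℚᵘ (+ m) 0))
                                                  (ℚ.toℚᵘ-fromℚᵘ (mkℚᵘ (+ n) 0)) ⟨
  toℚᵘ (ι m) ℚᵘ.+ toℚᵘ (ι n)         ≈⟨ ℚ.toℚᵘ-homo-+ (ι m) (ι n) ⟨
  toℚᵘ (ι m ℚ.+ ι n)                 ∎)
  where open ℚᵘ.≃-Reasoning

ι-∑ : ∀ {A : Set} (xs : List A) (f : A → ℕ) → ι (∑ xs f) ≡ ℚ∑.∑ xs (ι ∘ f)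
ι-∑ []       f = ≡.refl
ι-∑ (x ∷ xs) f = ≡.trans (ι-+ (f x) (∑ xs f)) (≡.cong (ι (f x) ℚ.+_) (ι-∑ xs f))

ι-𝟙* : ∀ b n → ι (𝟙 b * n) ≡ ℚ∑.𝟙 b ℚ.* ι n
ι-𝟙* true  n = ≡.trans (≡.cong ι (ℕ.*-identityˡ n)) (≡.sym (ℚ.*-identityˡ (ι n)))
ι-𝟙* false n = ≡.sym (ℚ.*-zeroˡ (ι n))

1/[a*c]*c≡1/a : ∀ {a} .{{_ : NonZero a}} c t → suc t ≡ a * c → (+ 1 / suc t) ℚ.* ι c ≡ + 1 / a
1/[a*c]*c≡1/a {suc a} c t 1+t≡a*c = ℚ.toℚᵘ-injective toℚᵘ-≃
  where
  cross : (+ 1 ℤ.* + c) ℤ.* + suc a ≡ + 1 ℤ.* + suc (t * 1)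
  cross = begin
    (+ 1 ℤ.* + c) ℤ.* + suc a   ≡⟨ ≡.cong (ℤ._* + suc a) (ℤ.*-identityˡ (+ c)) ⟩
    + c ℤ.* + suc a             ≡⟨ ℤ.pos-* c (suc a) ⟨
    + (c * suc a)               ≡⟨ ≡.cong +_ (ℕ.*-comm c (suc a)) ⟩
    + (suc a * c)               ≡⟨ ≡.cong +_ 1+t≡a*c ⟨
    + suc t                     ≡⟨ ≡.cong (+_ ∘ suc) (ℕ.*-identityʳ t) ⟨
    + suc (t * 1)               ≡⟨ ℤ.*-identityˡ (+ suc (t * 1)) ⟨
    + 1 ℤ.* + suc (t * 1)       ∎
    where open ≡-Reasoning
  toℚᵘ-≃ : toℚᵘ ((+ 1 / suc t) ℚ.* ι c) ℚᵘ.≃ toℚᵘ (+ 1 / suc a)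
  toℚᵘ-≃ = begin
    toℚᵘ ((+ 1 / suc t) ℚ.* ι c)         ≈⟨ ℚ.toℚᵘ-homo-* (+ 1 / suc t) (ι c) ⟩
    toℚᵘ (+ 1 / suc t) ℚᵘ.* toℚᵘ (ι c)   ≈⟨ ℚᵘ.*-cong (ℚ.toℚᵘ-fromℚᵘ (mkℚᵘ (+ 1) t))
                                                      (ℚ.toℚᵘ-fromℚᵘ (mkℚᵘ (+ c) 0)) ⟩
    mkℚᵘ (+ 1) t ℚᵘ.* mkℚᵘ (+ c) 0       ≈⟨ *≡* cross ⟩
    mkℚᵘ (+ 1) a                         ≈⟨ ℚ.toℚᵘ-fromℚᵘ (mkℚᵘ (+ 1) a) ⟨
    toℚᵘ (+ 1 / suc a)                   ∎
    where open ℚᵘ.≃-Reasoning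

module Expectation (P : FinPoset) (m : ℕ) where
  open ≡-Reasoning

  private
    E : List (Carrier P)
    E = elems P
    w : Carrier P → ℕ
    w = multichainsThrough P m

  expect-suc : ∀ W t → ∑ E w ≡ suc t → expect P W m ≡ (+ 1 / suc t) ℚ.* ℚ∑.∑ E (λ p → ι (w p) ℚ.* W p)
  expect-suc W t total≡ with sumℕ (map w E) | total≡
  ... | .(suc t) | ≡.refl = ≡.refl

  expect-zero : ∀ W → ∑ E w ≡ 0 → expect P W m ≡ 0ℚ
  expect-zero W total≡ with sumℕ (map w E) | total≡
  ... | .0 | ≡.refl = ≡.refl

  expect-∑ : ∀ {A : Set} (xs : List A) (W : A → Carrier P → ℚ) →
    expect P (λ p → sumℚ (map (λ k → W k p) xs)) m ≡ sumℚ (map (λ k → expect P (W k) m) xs)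
  expect-∑ xs W = by-total (∑ E w) ≡.refl
    where
    by-total : ∀ T → ∑ E w ≡ T →
      expect P (λ p → sumℚ (map (λ k → W k p) xs)) m ≡ sumℚ (map (λ k → expect P (W k) m) xs)
    by-total zero    total≡0 = ≡.trans (expect-zero _ total≡0)
      (≡.sym (≡.trans (ℚ∑.∑-cong xs (λ k → expect-zero (W k) total≡0)) (ℚ∑.∑-zero xs)))
    by-total (suc t) total≡ = begin
      expect P (λ p → ℚ∑.∑ xs (λ k → W k p)) m
        ≡⟨ expect-suc _ t total≡ ⟩
      (+ 1 / suc t) ℚ.* ℚ∑.∑ E (λ p → ι (w p) ℚ.* ℚ∑.∑ xs (λ k → W k p))
        ≡⟨ ≡.cong ((+ 1 / suc t) ℚ.*_)
             (≡.trans (ℚ∑.∑-cong E (λ p → ℚ∑.*-distribˡ-∑ (ι (w p)) xs _)) (ℚ∑.∑-comm E xs _)) ⟩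
      (+ 1 / suc t) ℚ.* ℚ∑.∑ xs (λ k → ℚ∑.∑ E (λ p → ι (w p) ℚ.* W k p))
        ≡⟨ ℚ∑.*-distribˡ-∑ (+ 1 / suc t) xs _ ⟩
      ℚ∑.∑ xs (λ k → (+ 1 / suc t) ℚ.* ℚ∑.∑ E (λ p → ι (w p) ℚ.* W k p))
        ≡⟨ ℚ∑.∑-cong xs (λ k → expect-suc (W k) t total≡) ⟨
      ℚ∑.∑ xs (λ k → expect P (W k) m)
        ∎

  expect-uniform : ∀ {a} .{{_ : NonZero a}} (π : Carrier P → Fin a) →
    (∀ i i′ → pushforward P π w i ≡ pushforward P π w i′) → 1 ≤ ∑ E w →
    (X : Fin a → ℚ) → expect P (X ∘ π) m ≡ (+ 1 / a) ℚ.* sumℚ (map X (allFin a))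
  expect-uniform {a} π uniform total≥1 X = by-total (∑ E w) ≡.refl total≥1
    where
    i₀ : Fin a
    i₀ = fromℕ< (>-nonZero⁻¹ a)
    c : ℕ
    c = pushforward P π w i₀
    total≡a*c : ∑ E w ≡ a * c
    total≡a*c = begin
      ∑ E w                                    ≡⟨ ∑-cong E (λ p → ℕ.*-identityʳ (w p)) ⟨
      ∑[ p ∈ E ] w p * 1                       ≡⟨ ∑-fibres E π w (λ _ → 1) ⟩
      ∑[ i ∈ allFin a ] pushforward P π w i * 1 ≡⟨ ∑-cong (allFin a) (λ i → ≡.cong (_* 1) (uniform i i₀)) ⟩
      ∑[ i ∈ allFin a ] c * 1                  ≡⟨ ∑-allFin-const a (c * 1) ⟩
      a * (c * 1)                              ≡⟨ ≡.cong (a *_) (ℕ.*-identityʳ c) ⟩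
      a * c                                    ∎
    weighted : ℚ∑.∑ E (λ p → ι (w p) ℚ.* X (π p)) ≡ ι c ℚ.* sumℚ (map X (allFin a))
    weighted = begin
      ℚ∑.∑ E (λ p → ι (w p) ℚ.* X (π p))
        ≡⟨ ℚ∑.∑-fibres E π (ι ∘ w) X ⟩
      ℚ∑.∑ (allFin a) (λ i → ℚ∑.∑ E (λ p → ℚ∑.𝟙 ⌊ π p Fin.≟ i ⌋ ℚ.* ι (w p)) ℚ.* X i)
        ≡⟨ ℚ∑.∑-cong (allFin a) (λ i → ≡.cong (ℚ._* X i) (≡.sym (≡.trans
             (ι-∑ E (λ p → 𝟙 ⌊ π p Fin.≟ i ⌋ * w p))
             (ℚ∑.∑-cong E (λ p → ι-𝟙* ⌊ π p Fin.≟ i ⌋ (w p)))))) ⟩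
      ℚ∑.∑ (allFin a) (λ i → ι (pushforward P π w i) ℚ.* X i)
        ≡⟨ ℚ∑.∑-cong (allFin a) (λ i → ≡.cong (λ v → ι v ℚ.* X i) (uniform i i₀)) ⟩
      ℚ∑.∑ (allFin a) (λ i → ι c ℚ.* X i)
        ≡⟨ ℚ∑.*-distribˡ-∑ (ι c) (allFin a) X ⟨
      ι c ℚ.* sumℚ (map X (allFin a))
        ∎
    by-total : ∀ T → ∑ E w ≡ T → 1 ≤ T → expect P (X ∘ π) m ≡ (+ 1 / a) ℚ.* sumℚ (map X (allFin a))
    by-total (suc t) total≡ _ = begin
      expect P (X ∘ π) m
        ≡⟨ expect-suc (X ∘ π) t total≡ ⟩
      (+ 1 / suc t) ℚ.* ℚ∑.∑ E (λ p → ι (w p) ℚ.* X (π p))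
        ≡⟨ ≡.cong ((+ 1 / suc t) ℚ.*_) weighted ⟩
      (+ 1 / suc t) ℚ.* (ι c ℚ.* sumℚ (map X (allFin a)))
        ≡⟨ ℚ.*-assoc (+ 1 / suc t) (ι c) _ ⟨
      ((+ 1 / suc t) ℚ.* ι c) ℚ.* sumℚ (map X (allFin a))
        ≡⟨ ≡.cong (ℚ._* sumℚ (map X (allFin a))) (1/[a*c]*c≡1/a c t (≡.trans (≡.sym total≡) total≡a*c)) ⟩
      (+ 1 / a) ℚ.* sumℚ (map X (allFin a))
        ∎

chain-expect : ∀ a .{{_ : NonZero a}} j (Y : Fin a → ℚ) →
  expect (chain a) Y (suc j) ≡ (+ 1 / a) ℚ.* sumℚ (map Y (allFin a))
chain-expect a j = Expectation.expect-uniform (chain a) (suc j) (λ y → y)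
  (ChainMarginal.multichainsThrough-uniform a j)
  (Multichains.total-pos (chain-isFinPoset a) (fromℕ< (>-nonZero⁻¹ a)) j)

coordinate-expect : ∀ {n} (a : Fin n → ℕ) → (∀ k → 1 ≤ a k) → ∀ k .{{_ : NonZero (a k)}} j (Y : Fin (a k) → ℚ) →
  expect (productPoset n a) (λ y → Y (y k)) (suc j) ≡ (+ 1 / a k) ℚ.* sumℚ (map Y (allFin (a k)))
coordinate-expect {suc n} a pos k j = Expectation.expect-uniform (productPoset (suc n) a) (suc j) (λ y → y k)
  (ProductMarginal.multichainsThrough-uniform a k j)
  (Multichains.total-pos (productPoset-isFinPoset (suc n) a) (λ l → fromℕ< (pos l)) j)

proposition2p18 : (n : ℕ) (a : Fin n → ℕ) → (∀ k → 1 ≤ a k)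
    → (X : (k : Fin n) → Fin (a k) → ℚ)
    → (m : ℕ) → 1 ≤ m
    → expect (productPoset n a) (λ i → sumℚ (map (λ k → X k (i k)) (allFin n))) m
    ≡ sumℚ (map (λ k → expect (chain (a k)) (X k) m) (allFin n))
proposition2p18 n a pos X (suc j) _ = ≡.trans
  (Expectation.expect-∑ (productPoset n a) (suc j) (allFin n) (λ k y → X k (y k)))
  (ℚ∑.∑-cong (allFin n) coordinate)
  where
  coordinate : ∀ k → expect (productPoset n a) (λ y → X k (y k)) (suc j) ≡ expect (chain (a k)) (X k) (suc j)
  coordinate k = ≡.trans (coordinate-expect a pos k j (X k)) (≡.sym (chain-expect (a k) j (X k)))
    where
    instance
      a-k-nonZero : NonZero (a k)
      a-k-nonZero = >-nonZero (pos k)
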